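{- Let $n=3b+1$ for some positive integer $b$. Then $va^\equiv_1(K_{2*n})=p(2b:n,n)$, and $va^\equiv_1(K_{k*n})=kb+\lceil k/2\rceil$ for every $k\ge 3$.
   Context: All graphs are finite and simple. For a graph $G$ with $N=|V(G)|$ vertices, an equitable $q$-coloring of $G$ is a partition of $V(G)$ into $q$ (possibly empty) independent sets, each of size $\lfloor N/q\rfloor$ or $\lceil N/q\rceil$. An equitable $(q,r)$-tree-coloring of $G$ is a partition of $V(G)$ into $q$ sets, each of size $\lfloor N/q\rfloor$ or $\lceil N/q\rceil$, such that each set induces a forest of maximum degree at most $r$. The strong equitable vertex $r$-arboricity $va^\equiv_r(G)$ is the minimum $p$ such that $G$ has an equitable $(q,r)$-tree-coloring for every integer $q\ge p$. $K_{n_1,\ldots,n_k}$ is the complete $k$-partite graph with partite sets of sizes $n_1,\ldots,n_k$, and $K_{k*n}$ denotes the complete $k$-partite graph with every partite set of size $n$. Definition of $p$: suppose $K_{n_1,\ldots,n_k}$ has an equitable $q$-coloring. Then $p(q:n_1,\ldots,n_k)=\lceil n_1/d\rceil+\cdots+\lceil n_k/d\rceil$, where $d$ is the minimum integer with $d\ge\lceil (n_1+\cdots+n_k)/q\rceil$ satisfying at least one of: (i) there exist $i\ne j$ such that neither $n_i$ nor $n_j$ is divisible by $d$; (ii) there exists $i$ with $n_i/\lfloor n_i/d\rfloor>d+1$. -}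

module Defs where

open import Data.Nat using (ℕ; zero; suc; _+_; _*_; _∸_; _≤_; _<_; NonZero)
open import Data.Nat.DivMod using (_/_)
open import Data.Nat.Divisibility using (_∣_)
open import Data.Fin using (Fin; quotient)
open import Data.Fin.Properties using () renaming (_≟_ to _≟F_)
open import Data.List using (List; []; length; filter; allFin; lookup; map; _∷_; _∷ʳ_)
open import Data.Nat.ListAction using (sum)
open import Data.List.Relation.Unary.All using (All)
open import Data.List.Relation.Unary.Unique.Propositional using (Unique)
open import Data.List.Relation.Unary.Linked using (Linked)
open import Data.Product using (Σ; _×_)
open import Data.Empty using (⊥)
open import Relation.Nullary using (¬_; Dec)
open import Relation.Nullary.Decidable using (_×-dec_; ¬?)
open import Relation.Binary.PropositionalEquality using (_≡_; _≢_)
open import Relation.Binary using (Decidable)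

record Graph : Set₁ where
  field
    N      : ℕ
    Adj    : Fin N → Fin N → Set
    adj?   : Decidable Adj
    sym    : ∀ {u v} → Adj u v → Adj v u
    irrefl : ∀ {v} → ¬ Adj v v

-- Integer division with total conventions (divisor 0 ↦ 0; never used
-- with divisor 0 in a meaningful way below).

⌊_/_⌋ : ℕ → ℕ → ℕ
⌊ m / zero ⌋  = 0
⌊ m / suc d ⌋ = m / suc d

⌈_/_⌉ : ℕ → ℕ → ℕ
⌈ m / zero ⌉  = 0
⌈ m / suc d ⌉ = (m + d) / suc d

-- Complete k-partite graph K_{k*n}: vertex v ∈ Fin (k * n) lies in
-- partite set `quotient n v ∈ Fin k`; two vertices are adjacent iff
-- they lie in different partite sets.

K : (k n : ℕ) → Graph
K k n = record
  { N      = k * n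
  ; Adj    = λ u v → quotient {k} n u ≢ quotient {k} n v
  ; adj?   = λ u v → ¬? (quotient {k} n u ≟F quotient {k} n v)
  ; sym    = λ p e → p (Data.Product.proj₁ (eqsym e))
  ; irrefl = λ p → p _≡_.refl
  }
  where
    open import Data.Product using (_,_)
    eqsym : ∀ {A : Set} {x y : A} → x ≡ y → Σ (y ≡ x) (λ _ → x ≡ y)
    eqsym _≡_.refl = _≡_.refl , _≡_.refl

-- Equitable (q,r)-tree-colorings.  A partition of V(G) into q sets is
-- given by a map c : V(G) → Fin q (class i = c⁻¹(i), possibly empty).

module _ (G : Graph) where
  open Graph G

  classSize : {q : ℕ} → (Fin N → Fin q) → Fin q → ℕ
  classSize c i = length (filter (λ v → c v ≟F i) (allFin N))

  classDeg : {q : ℕ} → (Fin N → Fin q) → Fin N → ℕ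
  classDeg c v = length (filter (λ u → (c u ≟F c v) ×-dec adj? v u) (allFin N))

  IsCycle : List (Fin N) → Set
  IsCycle [] = ⊥
  IsCycle (x ∷ xs) = (3 ≤ length (x ∷ xs)) × Unique (x ∷ xs)
                     × Linked Adj ((x ∷ xs) ∷ʳ x)

  InducesForestMaxDeg : {q : ℕ} → (Fin N → Fin q) → Fin q → ℕ → Set
  InducesForestMaxDeg c i r =
    (¬ Σ (List (Fin N)) (λ vs → IsCycle vs × All (λ v → c v ≡ i) vs))
    × (∀ v → c v ≡ i → classDeg c v ≤ r)

  EqTreeColoring : (q r : ℕ) → (Fin N → Fin q) → Set
  EqTreeColoring q r c =
    ∀ i → ((classSize c i ≡ ⌊ N / q ⌋) Data.Sum.⊎ (classSize c i ≡ ⌈ N / q ⌉))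
          × InducesForestMaxDeg c i r
    where import Data.Sum

  EqTreeColorable : (q r : ℕ) → Set
  EqTreeColorable q r = Σ (Fin N → Fin q) (EqTreeColoring q r)

  GoodFrom : ℕ → ℕ → Set
  GoodFrom r p = ∀ q → p ≤ q → 0 < q → EqTreeColorable q r

  IsStrongEqVA : ℕ → ℕ → Set
  IsStrongEqVA r m = GoodFrom r m × (∀ p → GoodFrom r p → m ≤ p)

-- The parameter p(q : n₁,…,n_k).  ns = [n₁,…,n_k].

CondPD : List ℕ → ℕ → Set
CondPD ns d =
  Σ (Fin (length ns)) (λ i → Σ (Fin (length ns)) (λ j →
      (i ≢ j) × (¬ d ∣ lookup ns i) × (¬ d ∣ lookup ns j)))
  Data.Sum.⊎
  Σ (Fin (length ns)) (λ i →
      (1 ≤ ⌊ lookup ns i / d ⌋) × ((suc d) * ⌊ lookup ns i / d ⌋ < lookup ns i))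
  where import Data.Sum

IsPD : ℕ → List ℕ → ℕ → Set
IsPD q ns d = (⌈ sum ns / q ⌉ ≤ d) × CondPD ns d
              × (∀ d' → ⌈ sum ns / q ⌉ ≤ d' → CondPD ns d' → d ≤ d')

pFrom : List ℕ → ℕ → ℕ
pFrom ns d = sum (map (λ m → ⌈ m / d ⌉) ns)

-- In an equitable (q,1)-tree-colouring of K_{k*n} a class with at
-- least three vertices must lie inside one part (two vertices in different parts would each be
-- adjacent to almost the whole class), so a part holds at most b of them.  Counting these large
-- classes shows that q = kb + ⌈k/2⌉ − 1 colours cannot work; conversely, for q ≥ kb + ⌈k/2⌉ one
-- lists the vertices so that the first 3b of every part come first, and cuts the list into
-- consecutive classes, the larger ones first.  For k = 2 and q ≥ 3 classes are too big to
-- straddle the parts, and the answer is governed by the least d ≥ 4 not dividing n: with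
-- 2⌈n/d⌉ − 1 colours the two parts would have to be covered by unequal numbers of classes, which
-- forces d ∣ n, while from 2⌈n/d⌉ colours on, each part can take half of the classes.
module Submission where

open import Defs
open import Data.Nat using (ℕ; zero; suc; _+_; _*_; _∸_; _≤_; _<_; z≤n; s≤s; _≤?_; _<?_; _≟_; ⌈_/2⌉; ⌊_/2⌋; >-nonZero)
open import Data.Nat.Properties
open import Data.Nat.DivMod using (_/_; _%_; m≡m%n+[m/n]*n; m%n<n; m/n*n≤m; m*n/n≡m; [m+kn]%n≡m%n; /-monoˡ-≤; m<n*o⇒m/o<n; m≥n⇒m/n>0)
open import Data.Nat.Divisibility using (_∣_; divides; _∣?_; ∣⇒≤)
open import Data.Nat.ListAction using (sum)
open import Data.Nat.ListAction.Properties using (sum-++)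
open import Data.Nat.Tactic.RingSolver using (solve-∀)
open import Data.Fin using (Fin; zero; suc; toℕ; fromℕ<; combine; quotient; remQuot; _↑ˡ_; _↑ʳ_)
open import Data.Fin.Properties using (toℕ<n; toℕ-injective; toℕ-fromℕ<; remQuot-combine) renaming (_≟_ to _≟ᶠ_; suc-injective to suc-injectiveᶠ)
open import Data.List using (List; []; _∷_; _++_; length; filter; tabulate; allFin; replicate; lookup)
open import Data.List.Properties using (length-++; length-replicate; length-tabulate)
open import Data.List.Membership.Propositional using (_∈_)
open import Data.List.Membership.Propositional.Properties using (∈-allFin)
open import Data.List.Relation.Unary.Any using (here; there)
open import Data.List.Relation.Unary.All using (All; _∷_)
open import Data.List.Relation.Unary.AllPairs using (_∷_)
open import Data.List.Relation.Unary.Linked using (_∷_)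
open import Data.Product using (Σ; _×_; _,_; proj₁; proj₂; uncurry)
open import Data.Sum using (_⊎_; inj₁; inj₂)
open import Data.Empty using (⊥; ⊥-elim)
open import Relation.Nullary using (¬_; Dec; yes; no)
open import Relation.Nullary.Decidable using (_×-dec_; ¬?)
open import Relation.Unary using (Decidable)
open import Relation.Binary.PropositionalEquality
open import Relation.Binary.Definitions using (tri<; tri≈; tri>)
open import Algebra.Properties.Semiring.Sum +-*-semiring using (sum-syntax; sum-cong-≗; ∑-distrib-+; ∑-comm; *-distribˡ-sum)

indicator : ∀ {p} {P : Set p} → Dec P → ℕ
indicator (yes _) = 1
indicator (no _)  = 0

indicator-cong : ∀ {P Q : Set} (p : Dec P) (q : Dec Q) → (P → Q) → (Q → P) → indicator p ≡ indicator q
indicator-cong (yes _) (yes _) _ _ = refl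
indicator-cong (yes p) (no ¬q) f _ = ⊥-elim (¬q (f p))
indicator-cong (no ¬p) (yes q) _ g = ⊥-elim (¬p (g q))
indicator-cong (no _)  (no _)  _ _ = refl

module _ {A : Set} where

  count : {P : A → Set} → Decidable P → List A → ℕ
  count P? xs = length (filter P? xs)

  count-∷ : {P : A → Set} (P? : Decidable P) → ∀ x xs → count P? (x ∷ xs) ≡ indicator (P? x) + count P? xs
  count-∷ P? x xs with P? x
  ... | yes _ = refl
  ... | no _  = refl

  count-++ : {P : A → Set} (P? : Decidable P) → ∀ xs ys → count P? (xs ++ ys) ≡ count P? xs + count P? ys
  count-++ P? []       ys = refl
  count-++ P? (x ∷ xs) ys with P? x
  ... | yes _ = cong suc (count-++ P? xs ys)
  ... | no _  = count-++ P? xs ys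

  count-mono : {P Q : A → Set} (P? : Decidable P) (Q? : Decidable Q) →
               (∀ x → P x → Q x) → ∀ xs → count P? xs ≤ count Q? xs
  count-mono P? Q? P⇒Q []       = z≤n
  count-mono P? Q? P⇒Q (x ∷ xs) with P? x | Q? x
  ... | yes p | yes _ = s≤s (count-mono P? Q? P⇒Q xs)
  ... | yes p | no ¬q = ⊥-elim (¬q (P⇒Q x p))
  ... | no _  | yes _ = m≤n⇒m≤1+n (count-mono P? Q? P⇒Q xs)
  ... | no _  | no _  = count-mono P? Q? P⇒Q xs

  count-mono-< : {P Q : A → Set} (P? : Decidable P) (Q? : Decidable Q) →
                 (∀ x → P x → Q x) → ∀ {w} xs → w ∈ xs → ¬ P w → Q w → count P? xs < count Q? xs
  count-mono-< P? Q? P⇒Q (x ∷ xs) (here refl) ¬pw qw with P? x | Q? x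
  ... | yes p | _     = ⊥-elim (¬pw p)
  ... | no _  | yes _ = s≤s (count-mono P? Q? P⇒Q xs)
  ... | no _  | no ¬q = ⊥-elim (¬q qw)
  count-mono-< P? Q? P⇒Q (x ∷ xs) (there w∈xs) ¬pw qw with P? x | Q? x
  ... | yes p | yes _ = s≤s (count-mono-< P? Q? P⇒Q xs w∈xs ¬pw qw)
  ... | yes p | no ¬q = ⊥-elim (¬q (P⇒Q x p))
  ... | no _  | yes _ = m≤n⇒m≤1+n (count-mono-< P? Q? P⇒Q xs w∈xs ¬pw qw)
  ... | no _  | no _  = count-mono-< P? Q? P⇒Q xs w∈xs ¬pw qw

  count-cong : {P Q : A → Set} (P? : Decidable P) (Q? : Decidable Q) →
               (∀ x → P x → Q x) → (∀ x → Q x → P x) → ∀ xs → count P? xs ≡ count Q? xs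
  count-cong P? Q? P⇒Q Q⇒P xs = ≤-antisym (count-mono P? Q? P⇒Q xs) (count-mono Q? P? Q⇒P xs)

  count-none : {P : A → Set} (P? : Decidable P) → (∀ x → ¬ P x) → ∀ xs → count P? xs ≡ 0
  count-none P? ¬P []       = refl
  count-none P? ¬P (x ∷ xs) with P? x
  ... | yes p = ⊥-elim (¬P x p)
  ... | no _  = count-none P? ¬P xs

  count>0⇒∃ : {P : A → Set} (P? : Decidable P) → ∀ xs → 0 < count P? xs → Σ A P
  count>0⇒∃ P? (x ∷ xs) pos with P? x
  ... | yes p = x , p
  ... | no _  = count>0⇒∃ P? xs pos

∑-mono-≤ : ∀ k {f g : Fin k → ℕ} → (∀ j → f j ≤ g j) → ∑[ j < k ] f j ≤ ∑[ j < k ] g j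
∑-mono-≤ zero    f≤g = z≤n
∑-mono-≤ (suc k) f≤g = +-mono-≤ (f≤g zero) (∑-mono-≤ k (λ j → f≤g (suc j)))

∑-const : ∀ k c → ∑[ j < k ] c ≡ k * c
∑-const zero    c = refl
∑-const (suc k) c = cong (c +_) (∑-const k c)

term≤∑ : ∀ k (f : Fin k → ℕ) j → f j ≤ ∑[ i < k ] f i
term≤∑ (suc k) f zero    = m≤m+n (f zero) _
term≤∑ (suc k) f (suc j) = ≤-trans (term≤∑ k (λ i → f (suc i)) j) (m≤n+m _ (f zero))

two-terms≤∑ : ∀ k (f : Fin k → ℕ) {j j'} → j ≢ j' → f j + f j' ≤ ∑[ i < k ] f i
two-terms≤∑ (suc k) f {zero}  {zero}   j≢j' = ⊥-elim (j≢j' refl)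
two-terms≤∑ (suc k) f {zero}  {suc j'} _    = +-monoʳ-≤ (f zero) (term≤∑ k (λ i → f (suc i)) j')
two-terms≤∑ (suc k) f {suc j} {zero}   _    =
  subst (_≤ ∑[ i < suc k ] f i) (+-comm (f zero) (f (suc j))) (+-monoʳ-≤ (f zero) (term≤∑ k (λ i → f (suc i)) j))
two-terms≤∑ (suc k) f {suc j} {suc j'} j≢j' =
  ≤-trans (two-terms≤∑ k (λ i → f (suc i)) (λ e → j≢j' (cong suc e))) (m≤n+m _ (f zero))

∑>0⇒∃ : ∀ k (f : Fin k → ℕ) → 0 < ∑[ i < k ] f i → Σ (Fin k) (λ j → 0 < f j)
∑>0⇒∃ (suc k) f pos with f zero in eq
... | suc _ = zero , subst (0 <_) (sym eq) (s≤s z≤n)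
... | zero  with ∑>0⇒∃ k (λ i → f (suc i)) pos
...   | j , fj>0 = suc j , fj>0

term<∑⇒∃other : ∀ k (f : Fin k → ℕ) j → f j < ∑[ i < k ] f i → Σ (Fin k) (λ j' → j' ≢ j × 0 < f j')
term<∑⇒∃other (suc k) f zero fj<∑ with ∑>0⇒∃ k (λ i → f (suc i)) (+-cancelˡ-< (f zero) 0 _
                                       (subst (_< ∑[ i < suc k ] f i) (sym (+-identityʳ (f zero))) fj<∑))
... | j' , fj'>0 = suc j' , (λ ()) , fj'>0
term<∑⇒∃other (suc k) f (suc j) fj<∑ with f zero in eq
... | suc _ = zero , (λ ()) , subst (0 <_) (sym eq) (s≤s z≤n)
... | zero  with term<∑⇒∃other k (λ i → f (suc i)) j fj<∑
...   | j' , j'≢j , fj'>0 = suc j' , (λ e → j'≢j (suc-injectiveᶠ e)) , fj'>0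

∑-zeroAt : ∀ k (f g : Fin k → ℕ) j → (∀ j' → j' ≢ j → g j' ≡ f j') → g j ≡ 0 →
           ∑[ i < k ] g i + f j ≡ ∑[ i < k ] f i
∑-zeroAt (suc k) f g zero    g≡f gj≡0 rewrite gj≡0 =
  trans (+-comm _ (f zero)) (cong (f zero +_) (sum-cong-≗ {k} (λ i → g≡f (suc i) (λ ()))))
∑-zeroAt (suc k) f g (suc j) g≡f gj≡0 = begin
  g zero + ∑[ i < k ] g (suc i) + f (suc j)   ≡⟨ +-assoc (g zero) _ _ ⟩
  g zero + (∑[ i < k ] g (suc i) + f (suc j)) ≡⟨ cong₂ _+_ (g≡f zero (λ ()))
    (∑-zeroAt k _ _ j (λ j' j'≢j → g≡f (suc j') (λ e → j'≢j (suc-injectiveᶠ e))) gj≡0) ⟩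
  f zero + ∑[ i < k ] f (suc i)               ∎
  where open ≡-Reasoning

∑-indicator-≡ : ∀ q (w : Fin q) → ∑[ i < q ] indicator (w ≟ᶠ i) ≡ 1
∑-indicator-≡ (suc q) zero = cong suc (trans (sum-cong-≗ {q} zero≢suc) (trans (∑-const q 0) (*-zeroʳ q)))
  where
  zero≢suc : ∀ i → indicator (zero ≟ᶠ suc i) ≡ 0
  zero≢suc i with zero ≟ᶠ suc i
  ... | no _ = refl
∑-indicator-≡ (suc q) (suc w) with suc w ≟ᶠ zero
... | no _ = trans (sum-cong-≗ {q} (λ i → indicator-cong (suc w ≟ᶠ suc i) (w ≟ᶠ i)
                    suc-injectiveᶠ (cong suc)))
                   (∑-indicator-≡ q w)

∑-count-≡ : ∀ {A : Set} q (g : A → Fin q) xs → ∑[ i < q ] count (λ x → g x ≟ᶠ i) xs ≡ length xs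
∑-count-≡ q g []       = trans (∑-const q 0) (*-zeroʳ q)
∑-count-≡ q g (x ∷ xs) = begin
  ∑[ i < q ] count (λ x → g x ≟ᶠ i) (x ∷ xs)
    ≡⟨ sum-cong-≗ {q} (λ i → count-∷ (λ x → g x ≟ᶠ i) x xs) ⟩
  ∑[ i < q ] (indicator (g x ≟ᶠ i) + count (λ x → g x ≟ᶠ i) xs)
    ≡⟨ ∑-distrib-+ (λ i → indicator (g x ≟ᶠ i)) _ ⟩
  ∑[ i < q ] indicator (g x ≟ᶠ i) + ∑[ i < q ] count (λ x → g x ≟ᶠ i) xs
    ≡⟨ cong₂ _+_ (∑-indicator-≡ q (g x)) (∑-count-≡ q g xs) ⟩
  suc (length xs) ∎
  where open ≡-Reasoning

countBelow : {P : ℕ → Set} → Decidable P → ℕ → ℕ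
countBelow P? L = ∑[ x < L ] indicator (P? (toℕ x))

countBelow-+ : {P : ℕ → Set} (P? : Decidable P) → ∀ a L →
               countBelow P? (a + L) ≡ countBelow P? a + countBelow (λ x → P? (a + x)) L
countBelow-+ P? zero    L = refl
countBelow-+ P? (suc a) L = trans (cong (indicator (P? 0) +_) (countBelow-+ (λ x → P? (suc x)) a L))
                                  (sym (+-assoc (indicator (P? 0)) _ _))

countBelow-cong : {P Q : ℕ → Set} (P? : Decidable P) (Q? : Decidable Q) → ∀ L →
                  (∀ x → x < L → P x → Q x) → (∀ x → x < L → Q x → P x) → countBelow P? L ≡ countBelow Q? L
countBelow-cong P? Q? L P⇒Q Q⇒P = sum-cong-≗ {L} λ x →
  indicator-cong (P? (toℕ x)) (Q? (toℕ x)) (P⇒Q (toℕ x) (toℕ<n x)) (Q⇒P (toℕ x) (toℕ<n x))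

countBelow-none : {P : ℕ → Set} (P? : Decidable P) → ∀ L → (∀ x → x < L → ¬ P x) → countBelow P? L ≡ 0
countBelow-none P? L ¬P = trans (sum-cong-≗ {L} absent) (trans (∑-const L 0) (*-zeroʳ L))
  where
  absent : ∀ x → indicator (P? (toℕ x)) ≡ 0
  absent x with P? (toℕ x)
  ... | yes p = ⊥-elim (¬P (toℕ x) (toℕ<n x) p)
  ... | no _  = refl

countBelow-all : {P : ℕ → Set} (P? : Decidable P) → ∀ L → (∀ x → x < L → P x) → countBelow P? L ≡ L
countBelow-all P? L allP = trans (sum-cong-≗ {L} present) (trans (∑-const L 1) (*-identityʳ L))
  where
  present : ∀ x → indicator (P? (toℕ x)) ≡ 1
  present x with P? (toℕ x)
  ... | yes _ = refl
  ... | no ¬p = ⊥-elim (¬p (allP (toℕ x) (toℕ<n x)))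

∑-countBelow-blocks : {P : ℕ → Set} (P? : Decidable P) → ∀ k n →
                      ∑[ j < k ] countBelow (λ o → P? (toℕ j * n + o)) n ≡ countBelow P? (k * n)
∑-countBelow-blocks {P} P? zero    n = refl
∑-countBelow-blocks {P} P? (suc k) n = trans (cong (countBelow P? n +_) (trans
  (sum-cong-≗ {k} λ j → countBelow-cong (λ o → P? (n + toℕ j * n + o)) (λ o → P? (n + (toℕ j * n + o))) n
    (λ x _ → subst P (+-assoc n (toℕ j * n) x)) (λ x _ → subst P (sym (+-assoc n (toℕ j * n) x))))
  (∑-countBelow-blocks (λ x → P? (n + x)) k n)))
  (sym (countBelow-+ P? n (k * n)))

module _ {A : Set} where

  count-tabulate : ∀ n (g : Fin n → A) {Q : A → Set} (Q? : Decidable Q) {R : ℕ → Set} (R? : Decidable R) →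
                   (∀ x → Q (g x) → R (toℕ x)) → (∀ x → R (toℕ x) → Q (g x)) →
                   count Q? (tabulate g) ≡ countBelow R? n
  count-tabulate zero    g Q? R? Q⇒R R⇒Q = refl
  count-tabulate (suc n) g Q? R? Q⇒R R⇒Q = trans (count-∷ Q? (g zero) _)
    (cong₂ _+_ (indicator-cong (Q? (g zero)) (R? 0) (Q⇒R zero) (R⇒Q zero))
               (count-tabulate n (λ x → g (suc x)) Q? (λ x → R? (suc x)) (λ x → Q⇒R (suc x)) (λ x → R⇒Q (suc x))))

  count-tabulate-∘ : {B : Set} → ∀ n (f : Fin n → B) (g : B → A) {Q : A → Set} (Q? : Decidable Q) →
                     count Q? (tabulate (λ x → g (f x))) ≡ count (λ b → Q? (g b)) (tabulate f)
  count-tabulate-∘ zero    f g Q? = refl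
  count-tabulate-∘ (suc n) f g Q? = trans (count-∷ Q? (g (f zero)) _)
    (trans (cong (indicator (Q? (g (f zero))) +_) (count-tabulate-∘ n (λ x → f (suc x)) g Q?))
           (sym (count-∷ (λ b → Q? (g b)) (f zero) _)))

  tabulate-+ : ∀ a b (g : Fin (a + b) → A) →
               tabulate g ≡ tabulate (λ i → g (i ↑ˡ b)) ++ tabulate (λ i → g (a ↑ʳ i))
  tabulate-+ zero    b g = refl
  tabulate-+ (suc a) b g = cong (g zero ∷_) (tabulate-+ a b (λ i → g (suc i)))

  count-tabulate-combine : ∀ k n (h : Fin (k * n) → A) {Q : A → Set} (Q? : Decidable Q) →
                           count Q? (tabulate h) ≡ ∑[ j < k ] count Q? (tabulate (λ o → h (combine j o)))
  count-tabulate-combine zero    n h Q? = refl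
  count-tabulate-combine (suc k) n h Q? = begin
    count Q? (tabulate h)
      ≡⟨ cong (count Q?) (tabulate-+ n (k * n) h) ⟩
    count Q? (tabulate (λ i → h (i ↑ˡ (k * n))) ++ tabulate (λ i → h (n ↑ʳ i)))
      ≡⟨ count-++ Q? (tabulate (λ i → h (i ↑ˡ (k * n)))) _ ⟩
    count Q? (tabulate (λ i → h (i ↑ˡ (k * n)))) + count Q? (tabulate (λ i → h (n ↑ʳ i)))
      ≡⟨ cong (count Q? (tabulate (λ i → h (i ↑ˡ (k * n)))) +_) (count-tabulate-combine k n (λ i → h (n ↑ʳ i)) Q?) ⟩
    ∑[ j < suc k ] count Q? (tabulate (λ o → h (combine j o))) ∎
    where open ≡-Reasoning

m*n≤o⇒m≤o/n : ∀ m o q' → m * suc q' ≤ o → m ≤ o / suc q'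
m*n≤o⇒m≤o/n m o q' m*q≤o = subst (_≤ o / suc q') (m*n/n≡m m (suc q')) (/-monoˡ-≤ (suc q') m*q≤o)

/-unique : ∀ {x t} q' → t * suc q' ≤ x → x < suc t * suc q' → x / suc q' ≡ t
/-unique {x} {t} q' lower upper = ≤-antisym (≤-pred (m<n*o⇒m/o<n upper)) (m*n≤o⇒m≤o/n t x q' lower)

m≡[m/n]*n+m%n : ∀ m q' → m ≡ m / suc q' * suc q' + m % suc q'
m≡[m/n]*n+m%n m q' = trans (m≡m%n+[m/n]*n m (suc q')) (+-comm (m % suc q') _)

⌈/⌉-unique : ∀ {N t} q' → t * suc q' < N → N ≤ suc t * suc q' → ⌈ N / suc q' ⌉ ≡ suc t
⌈/⌉-unique {N} {t} q' tq<N N≤[t+1]q = /-unique q'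
  (≤-trans (≤-reflexive (lemma t q')) (+-monoˡ-≤ q' tq<N))
  (≤-trans (s≤s (+-monoˡ-≤ q' N≤[t+1]q)) (≤-reflexive (lemma′ t q')))
  where
  lemma : ∀ t q' → suc t * suc q' ≡ suc (t * suc q') + q'
  lemma = solve-∀
  lemma′ : ∀ t q' → suc (suc t * suc q' + q') ≡ suc (suc t) * suc q'
  lemma′ = solve-∀

⌈/⌉≡1+quotient : ∀ {N s a} q' → N ≡ s * suc q' + a → 1 ≤ a → a < suc q' → ⌈ N / suc q' ⌉ ≡ suc s
⌈/⌉≡1+quotient {N} {s} {a} q' N≡ 1≤a a<q = ⌈/⌉-unique q'
  (subst (s * suc q' <_) (sym N≡) (subst (_≤ s * suc q' + a) (+-comm (s * suc q') 1) (+-monoʳ-≤ (s * suc q') 1≤a)))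
  (subst (_≤ suc s * suc q') (sym N≡) (subst (s * suc q' + a ≤_) (+-comm (s * suc q') (suc q')) (+-monoʳ-≤ (s * suc q') (<⇒≤ a<q))))

⌊/⌋≤⌈/⌉ : ∀ N q' → N / suc q' ≤ ⌈ N / suc q' ⌉
⌊/⌋≤⌈/⌉ N q' = /-monoˡ-≤ (suc q') (m≤m+n N q')

⌈/⌉≤1+⌊/⌋ : ∀ N q' → ⌈ N / suc q' ⌉ ≤ suc (N / suc q')
⌈/⌉≤1+⌊/⌋ N q' = ≤-pred (m<n*o⇒m/o<n (≤-trans (s≤s (+-monoˡ-≤ q' (≤-trans (≤-reflexive (m≡[m/n]*n+m%n N q'))
  (+-monoʳ-≤ (N / suc q' * suc q') (≤-pred (m%n<n N (suc q')))))))
  (≤-trans (n≤1+n _) (≤-reflexive (lemma (N / suc q') q')))))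
  where
  lemma : ∀ s q' → suc (suc (s * suc q' + q' + q')) ≡ suc (suc s) * suc q'
  lemma = solve-∀


m<[1+m/n]*n : ∀ m q' → m < suc (m / suc q') * suc q'
m<[1+m/n]*n m q' = subst (_< suc (m / suc q') * suc q') (sym (m≡[m/n]*n+m%n m q'))
  (subst (m / suc q' * suc q' + m % suc q' <_) (+-comm (m / suc q' * suc q') (suc q'))
         (+-monoʳ-< (m / suc q' * suc q') (m%n<n m (suc q'))))

quotient-combine : ∀ {k} n (j : Fin k) (o : Fin n) → quotient {k} n (combine j o) ≡ j
quotient-combine n j o = cong proj₁ (remQuot-combine j o)

module _ (k n : ℕ) {q : ℕ} (c : Fin (k * n) → Fin q) where

  open Graph (K k n) using (adj?)

  partCount : Fin q → Fin k → ℕ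
  partCount i j = count (λ o → c (combine j o) ≟ᶠ i) (allFin n)

  classSize≡∑partCount : ∀ i → classSize (K k n) c i ≡ ∑[ j < k ] partCount i j
  classSize≡∑partCount i = trans (count-tabulate-combine k n (λ v → v) (λ v → c v ≟ᶠ i))
    (sum-cong-≗ {k} λ j → count-tabulate-∘ n (λ o → o) (combine j) (λ v → c v ≟ᶠ i))

  ∑partCount≡n : ∀ j → ∑[ i < q ] partCount i j ≡ n
  ∑partCount≡n j = trans (∑-count-≡ q (λ o → c (combine j o)) (allFin n)) (length-tabulate (λ o → o))

  ∑classSize≡ : ∑[ i < q ] classSize (K k n) c i ≡ k * n
  ∑classSize≡ = trans (∑-count-≡ q c (allFin (k * n))) (length-tabulate (λ v → v))

  -- The neighbours of v in its class are exactly the class members outside v's part.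
  classDeg+partCount≡classSize : ∀ v →
    classDeg (K k n) c v + partCount (c v) (quotient {k} n v) ≡ classSize (K k n) c (c v)
  classDeg+partCount≡classSize v = begin
    classDeg (K k n) c v + partCount (c v) jv     ≡⟨ cong (_+ partCount (c v) jv) degree-by-parts ⟩
    ∑[ j < k ] nbrs j + partCount (c v) jv         ≡⟨ ∑-zeroAt k (partCount (c v)) nbrs jv other-parts own-part ⟩
    ∑[ j < k ] partCount (c v) j                   ≡⟨ classSize≡∑partCount (c v) ⟨
    classSize (K k n) c (c v)                      ∎
    where
    open ≡-Reasoning
    jv = quotient {k} n v
    Nbr? = λ u → (c u ≟ᶠ c v) ×-dec adj? v u
    nbrs : Fin k → ℕ
    nbrs j = count (λ o → Nbr? (combine j o)) (allFin n)
    degree-by-parts : classDeg (K k n) c v ≡ ∑[ j < k ] nbrs j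
    degree-by-parts = trans (count-tabulate-combine k n (λ u → u) Nbr?)
      (sum-cong-≗ {k} λ j → count-tabulate-∘ n (λ o → o) (combine j) Nbr?)
    other-parts : ∀ j → j ≢ jv → nbrs j ≡ partCount (c v) j
    other-parts j j≢jv = count-cong (λ o → Nbr? (combine j o)) (λ o → c (combine j o) ≟ᶠ c v) (λ _ → proj₁)
      (λ o same → same , λ e → j≢jv (trans (sym (quotient-combine n j o)) (sym e))) (allFin n)
    own-part : nbrs jv ≡ 0
    own-part = count-none _ (λ o nbr → proj₂ nbr (sym (quotient-combine n jv o))) (allFin n)

  inOnePart⇒forest : ∀ i → (∀ u v → c u ≡ i → c v ≡ i → quotient {k} n u ≡ quotient {k} n v) →
                      InducesForestMaxDeg (K k n) c i 1
  inOnePart⇒forest i samePart = noCycle , degree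
    where
    noCycle : ¬ Σ (List (Fin (k * n))) (λ vs → IsCycle (K k n) vs × All (λ v → c v ≡ i) vs)
    noCycle ((x ∷ [])     , (s≤s () , _) , _)
    noCycle ((x ∷ y ∷ ys) , (_ , _ , (x~y ∷ _)) , (cx ∷ cy ∷ _)) = x~y (samePart x y cx cy)
    degree : ∀ v → c v ≡ i → classDeg (K k n) c v ≤ 1
    degree v cv = ≤-trans (≤-reflexive (count-none _
      (λ u nbr → proj₂ nbr (samePart v u cv (trans (proj₁ nbr) cv))) (allFin (k * n)))) z≤n

  classSize≤2⇒forest : ∀ i → classSize (K k n) c i ≤ 2 → InducesForestMaxDeg (K k n) c i 1
  classSize≤2⇒forest i small = noCycle , degree
    where
    noCycle : ¬ Σ (List (Fin (k * n))) (λ vs → IsCycle (K k n) vs × All (λ v → c v ≡ i) vs)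
    noCycle ((x ∷ [])         , (s≤s () , _) , _)
    noCycle ((x ∷ y ∷ [])     , (s≤s (s≤s ()) , _) , _)
    noCycle ((x ∷ y ∷ z ∷ ws) , (_ , ((x≢y ∷ x≢z ∷ _) ∷ (y≢z ∷ _) ∷ _) , _) , (cx ∷ cy ∷ cz ∷ _)) =
      <⇒≱ (≤-trans (s≤s (≤-trans (s≤s (≤-trans (s≤s z≤n) three)) two)) one) small
      where
      In?    = λ u → c u ≟ᶠ i
      In-x?  = λ u → In? u ×-dec ¬? (u ≟ᶠ x)
      In-xy? = λ u → In-x? u ×-dec ¬? (u ≟ᶠ y)
      In-xyz? = λ u → In-xy? u ×-dec ¬? (u ≟ᶠ z)
      one   = count-mono-< In-x? In? (λ _ → proj₁) (allFin (k * n)) (∈-allFin x) (λ p → proj₂ p refl) cx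
      two   = count-mono-< In-xy? In-x? (λ _ → proj₁) (allFin (k * n)) (∈-allFin y) (λ p → proj₂ p refl)
                (cy , λ e → x≢y (sym e))
      three = count-mono-< In-xyz? In-xy? (λ _ → proj₁) (allFin (k * n)) (∈-allFin z) (λ p → proj₂ p refl)
                ((cz , λ e → x≢z (sym e)) , λ e → y≢z (sym e))
    degree : ∀ v → c v ≡ i → classDeg (K k n) c v ≤ 1
    degree v cv = ≤-pred (≤-trans (count-mono-< (λ u → (c u ≟ᶠ c v) ×-dec adj? v u) (λ u → c u ≟ᶠ i)
      (λ u nbr → trans (proj₁ nbr) cv) (allFin (k * n)) (∈-allFin v) (λ nbr → proj₂ nbr refl) cv) small)

  -- Two members v, u of the class in different parts have degrees S − y_v and S − y_u with
  -- y_v + y_u ≤ S; both being ≤ 1 forces S ≤ 2.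
  large-class-in-one-part : (∀ v → classDeg (K k n) c v ≤ 1) →
    ∀ i → 3 ≤ classSize (K k n) c i → Σ (Fin k) (λ j → classSize (K k n) c i ≤ partCount i j)
  large-class-in-one-part deg≤1 i large
    with count>0⇒∃ (λ v → c v ≟ᶠ i) (allFin (k * n)) (≤-trans (s≤s z≤n) large)
  ... | v , cv with classSize (K k n) c i ≤? partCount i (quotient {k} n v)
  ...   | yes inPart = quotient {k} n v , inPart
  ...   | no notInPart = ⊥-elim (<⇒≱ large (+-cancelʳ-≤ S S 2 (begin
      S + S                    ≤⟨ +-mono-≤ (≤-trans (≤-reflexive (sym eqv)) (+-monoˡ-≤ yv (deg≤1 v)))
                                           (≤-trans (≤-reflexive (sym equ)) (+-monoˡ-≤ yu (deg≤1 u))) ⟩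
      1 + yv + (1 + yu)        ≡⟨ cong suc (+-suc yv yu) ⟩
      2 + (yv + yu)            ≤⟨ +-monoʳ-≤ 2 (subst (yv + yu ≤_) (sym (classSize≡∑partCount i))
                                           (two-terms≤∑ k (partCount i) (λ e → j'≢jv (sym e)))) ⟩
      2 + S                    ∎)))
    where
    open ≤-Reasoning
    S  = classSize (K k n) c i
    jv = quotient {k} n v
    yv = partCount i jv
    other = term<∑⇒∃other k (partCount i) jv (subst (yv <_) (classSize≡∑partCount i) (≰⇒> notInPart))
    j' = proj₁ other
    j'≢jv = proj₁ (proj₂ other)
    member = count>0⇒∃ (λ o → c (combine j' o) ≟ᶠ i) (allFin n) (proj₂ (proj₂ other))
    u = combine j' (proj₁ member)
    yu = partCount i j'
    eqv : classDeg (K k n) c v + yv ≡ S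
    eqv = subst (λ t → classDeg (K k n) c v + partCount t jv ≡ classSize (K k n) c t) cv
                (classDeg+partCount≡classSize v)
    equ : classDeg (K k n) c u + yu ≡ S
    equ = subst (λ t → classDeg (K k n) c u + partCount t j' ≡ classSize (K k n) c t) (proj₂ member)
            (subst (λ t → classDeg (K k n) c u + partCount (c u) t ≡ classSize (K k n) c (c u))
                   (quotient-combine n j' (proj₁ member)) (classDeg+partCount≡classSize u))

module _ (k n : ℕ) {q : ℕ} (c : Fin (k * n) → Fin q) (deg≤1 : ∀ v → classDeg (K k n) c v ≤ 1) where

  largeClasses : ℕ
  largeClasses = ∑[ i < q ] indicator (3 ≤? classSize (K k n) c i)

  -- A part with fewer than 3(b+1) vertices contains at most b disjoint classes of size ≥ 3.
  largeClasses≤ : ∀ b → n < 3 * suc b → largeClasses ≤ k * b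
  largeClasses≤ b n<3[1+b] = begin
    ∑[ i < q ] indicator (3 ≤? classSize (K k n) c i) ≤⟨ ∑-mono-≤ q large≤triples ⟩
    ∑[ i < q ] ∑[ j < k ] (partCount k n c i j / 3)   ≡⟨ ∑-comm (λ i j → partCount k n c i j / 3) ⟩
    ∑[ j < k ] ∑[ i < q ] (partCount k n c i j / 3)   ≤⟨ ∑-mono-≤ k triplesInPart≤ ⟩
    ∑[ j < k ] b                                      ≡⟨ ∑-const k b ⟩
    k * b                                             ∎
    where
    open ≤-Reasoning
    large≤triples : ∀ i → indicator (3 ≤? classSize (K k n) c i) ≤ ∑[ j < k ] (partCount k n c i j / 3)
    large≤triples i with 3 ≤? classSize (K k n) c i
    ... | no _ = z≤n
    ... | yes large with large-class-in-one-part k n c deg≤1 i large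
    ...   | j , inPart = ≤-trans (m≥n⇒m/n>0 (≤-trans large inPart)) (term≤∑ k (λ j → partCount k n c i j / 3) j)
    triplesInPart≤ : ∀ j → ∑[ i < q ] (partCount k n c i j / 3) ≤ b
    triplesInPart≤ j = ≤-pred (*-cancelˡ-< 3 _ (suc b) (≤-<-trans (begin
      3 * ∑[ i < q ] (partCount k n c i j / 3) ≡⟨ *-distribˡ-sum 3 (λ i → partCount k n c i j / 3) ⟩
      ∑[ i < q ] (3 * (partCount k n c i j / 3)) ≤⟨ ∑-mono-≤ q (λ i → ≤-trans (≤-reflexive (*-comm 3 (partCount k n c i j / 3)))
                                                                   (m/n*n≤m (partCount k n c i j) 3)) ⟩
      ∑[ i < q ] partCount k n c i j              ≡⟨ ∑partCount≡n k n c j ⟩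
      n                                            ∎) n<3[1+b]))

  module _ (allLarge : ∀ i → 3 ≤ classSize (K k n) c i) where

    home : Fin q → Fin k
    home i = proj₁ (large-class-in-one-part k n c deg≤1 i (allLarge i))

    partCount-home : ∀ i → partCount k n c i (home i) ≡ classSize (K k n) c i
    partCount-home i = ≤-antisym
      (subst (partCount k n c i (home i) ≤_) (sym (classSize≡∑partCount k n c i)) (term≤∑ k (partCount k n c i) (home i)))
      (proj₂ (large-class-in-one-part k n c deg≤1 i (allLarge i)))

    partCount-away : ∀ i j → home i ≢ j → partCount k n c i j ≡ 0
    partCount-away i j home≢j = n≤0⇒n≡0 (+-cancelˡ-≤ (classSize (K k n) c i) _ 0 (begin
      classSize (K k n) c i + partCount k n c i j      ≡⟨ cong (_+ partCount k n c i j) (partCount-home i) ⟨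
      partCount k n c i (home i) + partCount k n c i j ≤⟨ two-terms≤∑ k (partCount k n c i) home≢j ⟩
      ∑[ j < k ] partCount k n c i j                   ≡⟨ classSize≡∑partCount k n c i ⟨
      classSize (K k n) c i                            ≡⟨ +-identityʳ _ ⟨
      classSize (K k n) c i + 0                        ∎))
      where open ≤-Reasoning

    classesIn : Fin k → ℕ
    classesIn j = ∑[ i < q ] indicator (1 ≤? partCount k n c i j)

    ∑classesIn≡q : ∑[ j < k ] classesIn j ≡ q
    ∑classesIn≡q = begin
      ∑[ j < k ] ∑[ i < q ] indicator (1 ≤? partCount k n c i j) ≡⟨ ∑-comm (λ j i → indicator (1 ≤? partCount k n c i j)) ⟩
      ∑[ i < q ] ∑[ j < k ] indicator (1 ≤? partCount k n c i j) ≡⟨ sum-cong-≗ {q} (λ i →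
        trans (sum-cong-≗ {k} (λ j → indicator-cong (1 ≤? partCount k n c i j) (home i ≟ᶠ j) (meets⇒home i j) (home⇒meets i j)))
              (∑-indicator-≡ k (home i))) ⟩
      ∑[ i < q ] 1                                               ≡⟨ trans (∑-const q 1) (*-identityʳ q) ⟩
      q                                                          ∎
      where
      open ≡-Reasoning
      meets⇒home : ∀ i j → 1 ≤ partCount k n c i j → home i ≡ j
      meets⇒home i j meets with home i ≟ᶠ j
      ... | yes e = e
      ... | no ne = ⊥-elim (<⇒≱ meets (≤-reflexive (partCount-away i j ne)))
      home⇒meets : ∀ i j → home i ≡ j → 1 ≤ partCount k n c i j
      home⇒meets i j refl = subst (1 ≤_) (sym (partCount-home i)) (≤-trans (s≤s z≤n) (allLarge i))

    classesIn-bounds : ∀ s → (∀ i → s ≤ classSize (K k n) c i × classSize (K k n) c i ≤ suc s) →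
                       ∀ j → s * classesIn j ≤ n × n ≤ suc s * classesIn j
    classesIn-bounds s sizes j =
      subst₂ _≤_ (sym (*-distribˡ-sum s meets)) (∑partCount≡n k n c j) (∑-mono-≤ q (λ i → proj₁ (termwise i))) ,
      subst₂ _≤_ (∑partCount≡n k n c j) (sym (*-distribˡ-sum (suc s) meets)) (∑-mono-≤ q (λ i → proj₂ (termwise i)))
      where
      meets : Fin q → ℕ
      meets i = indicator (1 ≤? partCount k n c i j)
      termwise : ∀ i → s * meets i ≤ partCount k n c i j × partCount k n c i j ≤ suc s * meets i
      termwise i with home i ≟ᶠ j
      ... | no ne rewrite partCount-away i j ne = ≤-reflexive (*-zeroʳ s) , z≤n
      ... | yes refl rewrite partCount-home i with 1 ≤? classSize (K k n) c i
      ...   | yes _ = ≤-trans (≤-reflexive (*-identityʳ s)) (proj₁ (sizes i)) ,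
                      ≤-trans (proj₂ (sizes i)) (≤-reflexive (sym (*-identityʳ (suc s))))
      ...   | no small = ⊥-elim (small (≤-trans (s≤s z≤n) (allLarge i)))

nth : List ℕ → ℕ → ℕ
nth []       _       = 0
nth (z ∷ zs) zero    = z
nth (z ∷ zs) (suc i) = nth zs i

nth-++ˡ : ∀ zs ws i → i < length zs → nth (zs ++ ws) i ≡ nth zs i
nth-++ˡ (z ∷ zs) ws zero    _         = refl
nth-++ˡ (z ∷ zs) ws (suc i) (s≤s i<l) = nth-++ˡ zs ws i i<l

nth-++ʳ : ∀ zs ws i → nth (zs ++ ws) (length zs + i) ≡ nth ws i
nth-++ʳ []       ws i = refl
nth-++ʳ (z ∷ zs) ws i = nth-++ʳ zs ws i

nth-replicate : ∀ a s i → i < a → nth (replicate a s) i ≡ s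
nth-replicate (suc a) s zero    _         = refl
nth-replicate (suc a) s (suc i) (s≤s i<a) = nth-replicate a s i i<a

chunkIndex : List ℕ → ℕ → ℕ
chunkIndex []       x = 0
chunkIndex (z ∷ zs) x with x <? z
... | yes _ = 0
... | no _  = suc (chunkIndex zs (x ∸ z))

chunkIndex-head : ∀ z zs x → x < z → chunkIndex (z ∷ zs) x ≡ 0
chunkIndex-head z zs x x<z with x <? z
... | yes _ = refl
... | no x≮z = ⊥-elim (x≮z x<z)

chunkIndex-tail : ∀ z zs y → chunkIndex (z ∷ zs) (z + y) ≡ suc (chunkIndex zs y)
chunkIndex-tail z zs y with z + y <? z
... | yes z+y<z = ⊥-elim (m+n≮m z y z+y<z)
... | no _      = cong (λ t → suc (chunkIndex zs t)) (m+n∸m≡n z y)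

countBelow-chunkIndex : ∀ zs i → countBelow (λ x → chunkIndex zs x ≟ i) (sum zs) ≡ nth zs i
countBelow-chunkIndex []       i = refl
countBelow-chunkIndex (z ∷ zs) i = trans (countBelow-+ (λ x → chunkIndex (z ∷ zs) x ≟ i) z (sum zs)) (split i)
  where
  split : ∀ i → countBelow (λ x → chunkIndex (z ∷ zs) x ≟ i) z
              + countBelow (λ x → chunkIndex (z ∷ zs) (z + x) ≟ i) (sum zs) ≡ nth (z ∷ zs) i
  split zero = trans (cong₂ _+_
    (countBelow-all (λ x → chunkIndex (z ∷ zs) x ≟ 0) z (λ x x<z → chunkIndex-head z zs x x<z))
    (countBelow-none (λ x → chunkIndex (z ∷ zs) (z + x) ≟ 0) (sum zs) (λ x _ e → 0≢1+n (trans (sym e) (chunkIndex-tail z zs x)))))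
    (+-identityʳ z)
  split (suc i) = cong₂ _+_
    (countBelow-none (λ x → chunkIndex (z ∷ zs) x ≟ suc i) z (λ x x<z e → 0≢1+n (trans (sym (chunkIndex-head z zs x x<z)) e)))
    (trans (countBelow-cong (λ x → chunkIndex (z ∷ zs) (z + x) ≟ suc i) (λ x → chunkIndex zs x ≟ i) (sum zs)
             (λ x _ e → suc-injective (trans (sym (chunkIndex-tail z zs x)) e))
             (λ x _ e → trans (chunkIndex-tail z zs x) (cong suc e)))
           (countBelow-chunkIndex zs i))

chunkIndex<length : ∀ zs x → x < sum zs → chunkIndex zs x < length zs
chunkIndex<length (z ∷ zs) x x<∑ with x <? z
... | yes _   = s≤s z≤n
... | no x≮z = s≤s (chunkIndex<length zs (x ∸ z) (+-cancelˡ-< z _ _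
                 (subst (_< z + sum zs) (sym (m+[n∸m]≡n (≮⇒≥ x≮z))) x<∑)))

chunkIndex-++ˡ : ∀ zs ws x → x < sum zs → chunkIndex (zs ++ ws) x ≡ chunkIndex zs x
chunkIndex-++ˡ (z ∷ zs) ws x x<∑ with x <? z
... | yes _   = refl
... | no x≮z = cong suc (chunkIndex-++ˡ zs ws (x ∸ z) (+-cancelˡ-< z _ _
                 (subst (_< z + sum zs) (sym (m+[n∸m]≡n (≮⇒≥ x≮z))) x<∑)))

chunkIndex-++ʳ : ∀ zs ws y → chunkIndex (zs ++ ws) (sum zs + y) ≡ length zs + chunkIndex ws y
chunkIndex-++ʳ []       ws y = refl
chunkIndex-++ʳ (z ∷ zs) ws y = trans (cong (chunkIndex (z ∷ (zs ++ ws))) (+-assoc z (sum zs) y))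
  (trans (chunkIndex-tail z (zs ++ ws) (sum zs + y)) (cong suc (chunkIndex-++ʳ zs ws y)))

chunkIndex-replicate : ∀ a m rest x i → chunkIndex (replicate a m ++ rest) x ≡ i → i < a →
                       m * i ≤ x × x < m * i + m
chunkIndex-replicate (suc a) m rest x i idx≡i i<a with x <? m
... | yes x<m = subst (λ i → m * i ≤ x × x < m * i + m) idx≡i
                  (≤-trans (≤-reflexive (*-zeroʳ m)) z≤n , subst (x <_) (cong (_+ m) (sym (*-zeroʳ m))) x<m)
chunkIndex-replicate (suc a) m rest x zero    idx≡i i<a       | no _   = ⊥-elim (0≢1+n (sym idx≡i))
chunkIndex-replicate (suc a) m rest x (suc i) idx≡i (s≤s i<a) | no x≮m
  with chunkIndex-replicate a m rest (x ∸ m) i (suc-injective idx≡i) i<a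
... | lower , upper = subst (λ t → m * suc i ≤ t × t < m * suc i + m) (m+[n∸m]≡n (≮⇒≥ x≮m))
  (subst (_≤ m + (x ∸ m)) (sym (*-suc m i)) (+-monoʳ-≤ m lower) ,
   subst (m + (x ∸ m) <_) (sym (trans (cong (_+ m) (*-suc m i)) (+-assoc m (m * i) m))) (+-monoʳ-< m upper))

balanced : ℕ → ℕ → ℕ → List ℕ
balanced m s a = replicate a (suc s) ++ replicate (m ∸ a) s

length-balanced : ∀ m s a → a ≤ m → length (balanced m s a) ≡ m
length-balanced m s a a≤m = trans (length-++ (replicate a (suc s)))
  (trans (cong₂ _+_ (length-replicate a) (length-replicate (m ∸ a))) (m+[n∸m]≡n a≤m))

sum-replicate : ∀ a s → sum (replicate a s) ≡ a * s
sum-replicate zero    s = refl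
sum-replicate (suc a) s = cong (s +_) (sum-replicate a s)

sum-balanced : ∀ m s a → a ≤ m → sum (balanced m s a) ≡ m * s + a
sum-balanced m s a a≤m = begin
  sum (balanced m s a)                 ≡⟨ sum-++ (replicate a (suc s)) _ ⟩
  sum (replicate a (suc s)) + sum (replicate (m ∸ a) s) ≡⟨ cong₂ _+_ (sum-replicate a (suc s)) (sum-replicate (m ∸ a) s) ⟩
  a * suc s + (m ∸ a) * s              ≡⟨ cong (_+ (m ∸ a) * s) (*-suc a s) ⟩
  a + a * s + (m ∸ a) * s              ≡⟨ +-assoc a _ _ ⟩
  a + (a * s + (m ∸ a) * s)            ≡⟨ cong (a +_) (*-distribʳ-+ s a (m ∸ a)) ⟨
  a + (a + (m ∸ a)) * s                ≡⟨ cong (λ t → a + t * s) (m+[n∸m]≡n a≤m) ⟩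
  a + m * s                            ≡⟨ +-comm a _ ⟩
  m * s + a                            ∎
  where open ≡-Reasoning

nth-balanced : ∀ m s a i → i < m → (i < a × nth (balanced m s a) i ≡ suc s) ⊎ nth (balanced m s a) i ≡ s
nth-balanced m s a i i<m with i <? a
... | yes i<a = inj₁ (i<a , trans (nth-++ˡ (replicate a (suc s)) _ i (subst (i <_) (sym (length-replicate a)) i<a))
                                  (nth-replicate a (suc s) i i<a))
... | no i≮a = inj₂ (begin
  nth (balanced m s a) i                                 ≡⟨ cong (nth (balanced m s a)) (m+[n∸m]≡n a≤i) ⟨
  nth (balanced m s a) (a + (i ∸ a))                     ≡⟨ cong (λ l → nth (balanced m s a) (l + (i ∸ a))) (length-replicate a) ⟨
  nth (balanced m s a) (length (replicate a (suc s)) + (i ∸ a)) ≡⟨ nth-++ʳ (replicate a (suc s)) _ (i ∸ a) ⟩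
  nth (replicate (m ∸ a) s) (i ∸ a)                      ≡⟨ nth-replicate (m ∸ a) s (i ∸ a) (∸-monoˡ-< i<m a≤i) ⟩
  s                                                      ∎)
  where
  open ≡-Reasoning
  a≤i = ≮⇒≥ i≮a

nth-++-∀ : ∀ (P : ℕ → Set) zs ws → (∀ i → i < length zs → P (nth zs i)) → (∀ i → i < length ws → P (nth ws i)) →
           ∀ i → i < length (zs ++ ws) → P (nth (zs ++ ws) i)
nth-++-∀ P []       ws _  Pws i i<l = Pws i i<l
nth-++-∀ P (z ∷ zs) ws Pzs Pws zero    _         = Pzs zero (s≤s z≤n)
nth-++-∀ P (z ∷ zs) ws Pzs Pws (suc i) (s≤s i<l) = nth-++-∀ P zs ws (λ i i<l → Pzs (suc i) (s≤s i<l)) Pws i i<l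

chunkIndex-++-< : ∀ zs ws x → x < sum zs → chunkIndex (zs ++ ws) x < length zs
chunkIndex-++-< zs ws x x<∑ = subst (_< length zs) (sym (chunkIndex-++ˡ zs ws x x<∑)) (chunkIndex<length zs x x<∑)

chunkIndex-++-≥ : ∀ zs ws y → length zs ≤ chunkIndex (zs ++ ws) (sum zs + y)
chunkIndex-++-≥ zs ws y = subst (length zs ≤_) (sym (chunkIndex-++ʳ zs ws y)) (m≤m+n (length zs) _)

-- n can be cut into m pieces of sizes s and s + 1.
Fits : ℕ → ℕ → ℕ → Set
Fits n m s = m * s ≤ n × n ≤ m * s + m

-- pos j o is the position in [0, k n) given to vertex o of part j; every position is used once.
Enumerates : ℕ → ℕ → (ℕ → ℕ → ℕ) → Set₁
Enumerates k n pos = (∀ j o → j < k → o < n → pos j o < k * n)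
  × (∀ {P : ℕ → Set} (P? : Decidable P) → ∑[ j < k ] countBelow (λ o → P? (pos (toℕ j) o)) n ≡ countBelow P? (k * n))

-- Colour vertex (j , o) by the block of zs containing pos j o.
module ChunkColoring (k n q' : ℕ) (zs : List ℕ) (pos : ℕ → ℕ → ℕ) (enum : Enumerates k n pos)
  (length≡ : length zs ≡ suc q') (sum≡ : sum zs ≡ k * n)
  (equitable : ∀ i → i < suc q' → nth zs i ≡ ⌊ k * n / suc q' ⌋ ⊎ nth zs i ≡ ⌈ k * n / suc q' ⌉)
  (forest : ∀ i → i < suc q' → nth zs i ≤ 2 ⊎
     (∀ j o j' o' → j < k → o < n → j' < k → o' < n →
        chunkIndex zs (pos j o) ≡ i → chunkIndex zs (pos j' o') ≡ i → j ≡ j'))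
  where

  index : Fin k → Fin n → ℕ
  index j o = chunkIndex zs (pos (toℕ j) (toℕ o))

  index< : ∀ j o → index j o < suc q'
  index< j o = subst (index j o <_) length≡ (chunkIndex<length zs _
    (subst (pos (toℕ j) (toℕ o) <_) (sym sum≡) (proj₁ enum _ _ (toℕ<n j) (toℕ<n o))))

  colour : Fin k → Fin n → Fin (suc q')
  colour j o = fromℕ< (index< j o)

  c : Fin (k * n) → Fin (suc q')
  c v = uncurry colour (remQuot {k} n v)

  toℕ-c : ∀ v → toℕ (c v) ≡ index (proj₁ (remQuot {k} n v)) (proj₂ (remQuot {k} n v))
  toℕ-c v = toℕ-fromℕ< _

  c-combine : ∀ j o → toℕ (c (combine j o)) ≡ index j o
  c-combine j o = trans (cong (λ jo → toℕ (uncurry colour jo)) (remQuot-combine j o)) (toℕ-fromℕ< _)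

  classSize≡nth : ∀ i → classSize (K k n) c i ≡ nth zs (toℕ i)
  classSize≡nth i = begin
    classSize (K k n) c i                                  ≡⟨ classSize≡∑partCount k n c i ⟩
    ∑[ j < k ] partCount k n c i j                         ≡⟨ sum-cong-≗ {k} (λ j → count-tabulate n (λ o → o)
        (λ o → c (combine j o) ≟ᶠ i) (λ x → chunkIndex zs (pos (toℕ j) x) ≟ toℕ i)
        (λ o e → trans (sym (c-combine j o)) (cong toℕ e))
        (λ o e → toℕ-injective (trans (c-combine j o) e))) ⟩
    ∑[ j < k ] countBelow (λ x → chunkIndex zs (pos (toℕ j) x) ≟ toℕ i) n ≡⟨ proj₂ enum (λ x → chunkIndex zs x ≟ toℕ i) ⟩
    countBelow (λ x → chunkIndex zs x ≟ toℕ i) (k * n)      ≡⟨ cong (countBelow (λ x → chunkIndex zs x ≟ toℕ i)) sum≡ ⟨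
    countBelow (λ x → chunkIndex zs x ≟ toℕ i) (sum zs)     ≡⟨ countBelow-chunkIndex zs (toℕ i) ⟩
    nth zs (toℕ i)                                         ∎
    where open ≡-Reasoning

  colorable : EqTreeColorable (K k n) (suc q') 1
  colorable = c , λ i → sizes i , forests i
    where
    sizes : ∀ i → classSize (K k n) c i ≡ ⌊ k * n / suc q' ⌋ ⊎ classSize (K k n) c i ≡ ⌈ k * n / suc q' ⌉
    sizes i with equitable (toℕ i) (toℕ<n i)
    ... | inj₁ e = inj₁ (trans (classSize≡nth i) e)
    ... | inj₂ e = inj₂ (trans (classSize≡nth i) e)
    forests : ∀ i → InducesForestMaxDeg (K k n) c i 1
    forests i with forest (toℕ i) (toℕ<n i)
    ... | inj₁ small = classSize≤2⇒forest k n c i (subst (_≤ 2) (sym (classSize≡nth i)) small)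
    ... | inj₂ onePart = inOnePart⇒forest k n c i λ u v cu cv → toℕ-injective (onePart _ _ _ _
      (toℕ<n (proj₁ (remQuot {k} n u))) (toℕ<n (proj₂ (remQuot {k} n u)))
      (toℕ<n (proj₁ (remQuot {k} n v))) (toℕ<n (proj₂ (remQuot {k} n v)))
      (trans (sym (toℕ-c u)) (cong toℕ cu)) (trans (sym (toℕ-c v)) (cong toℕ cv)))

rowMajor : ℕ → ℕ → ℕ → ℕ
rowMajor n j o = j * n + o

rowMajor-enumerates : ∀ k n → Enumerates k n (rowMajor n)
rowMajor-enumerates k n = range , (λ P? → ∑-countBelow-blocks P? k n)
  where
  range : ∀ j o → j < k → o < n → rowMajor n j o < k * n
  range j o j<k o<n = ≤-trans (+-monoʳ-< (j * n) o<n) (≤-trans (≤-reflexive (+-comm (j * n) n)) (*-monoˡ-≤ n j<k))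

-- For parts of size 3b + 1: the first 3b vertices of all parts in row-major order, then the
-- k leftover vertices.  Consecutive triples in the first region stay inside one part.
triplesFirst : ℕ → ℕ → ℕ → ℕ → ℕ
triplesFirst k b j o with o <? 3 * b
... | yes _ = j * (3 * b) + o
... | no _  = k * (3 * b) + j

triplesFirst-< : ∀ k b j o → o < 3 * b → triplesFirst k b j o ≡ j * (3 * b) + o
triplesFirst-< k b j o o<3b with o <? 3 * b
... | yes _    = refl
... | no o≮3b = ⊥-elim (o≮3b o<3b)

triplesFirst-≥ : ∀ k b j o → ¬ o < 3 * b → triplesFirst k b j o ≡ k * (3 * b) + j
triplesFirst-≥ k b j o o≮3b with o <? 3 * b
... | yes o<3b = ⊥-elim (o≮3b o<3b)
... | no _     = refl

triplesFirst-enumerates : ∀ k b → Enumerates k (3 * b + 1) (triplesFirst k b)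
triplesFirst-enumerates k b = range , counts
  where
  k[3b+1] : ∀ k b → k * (3 * b) + k ≡ k * (3 * b + 1)
  k[3b+1] = solve-∀
  range : ∀ j o → j < k → o < 3 * b + 1 → triplesFirst k b j o < k * (3 * b + 1)
  range j o j<k o<n with o <? 3 * b
  ... | yes o<3b = ≤-trans (proj₁ (rowMajor-enumerates k (3 * b)) j o j<k o<3b) (*-monoʳ-≤ k (m≤m+n (3 * b) 1))
  ... | no _     = subst (k * (3 * b) + j <_) (k[3b+1] k b) (+-monoʳ-< (k * (3 * b)) j<k)
  counts : ∀ {P : ℕ → Set} (P? : Decidable P) →
           ∑[ j < k ] countBelow (λ o → P? (triplesFirst k b (toℕ j) o)) (3 * b + 1) ≡ countBelow P? (k * (3 * b + 1))
  counts P? = begin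
    ∑[ j < k ] countBelow (λ o → P? (triplesFirst k b (toℕ j) o)) (3 * b + 1)
      ≡⟨ sum-cong-≗ {k} (λ j → perPart (toℕ j)) ⟩
    ∑[ j < k ] (countBelow (λ o → P? (toℕ j * (3 * b) + o)) (3 * b) + indicator (P? (k * (3 * b) + toℕ j)))
      ≡⟨ ∑-distrib-+ {k} (λ j → countBelow (λ o → P? (toℕ j * (3 * b) + o)) (3 * b)) (λ j → indicator (P? (k * (3 * b) + toℕ j))) ⟩
    ∑[ j < k ] countBelow (λ o → P? (toℕ j * (3 * b) + o)) (3 * b) + countBelow (λ j → P? (k * (3 * b) + j)) k
      ≡⟨ cong (_+ countBelow (λ j → P? (k * (3 * b) + j)) k) (∑-countBelow-blocks P? k (3 * b)) ⟩
    countBelow P? (k * (3 * b)) + countBelow (λ j → P? (k * (3 * b) + j)) k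
      ≡⟨ countBelow-+ P? (k * (3 * b)) k ⟨
    countBelow P? (k * (3 * b) + k)
      ≡⟨ cong (countBelow P?) (k[3b+1] k b) ⟩
    countBelow P? (k * (3 * b + 1)) ∎
    where
    open ≡-Reasoning
    perPart : ∀ j → countBelow (λ o → P? (triplesFirst k b j o)) (3 * b + 1)
                  ≡ countBelow (λ o → P? (j * (3 * b) + o)) (3 * b) + indicator (P? (k * (3 * b) + j))
    perPart j = trans (countBelow-+ (λ o → P? (triplesFirst k b j o)) (3 * b) 1)
      (cong₂ _+_ (sum-cong-≗ {3 * b} (λ o → cong (λ x → indicator (P? x)) (triplesFirst-< k b j (toℕ o) (toℕ<n o))))
                 (trans (+-identityʳ _) (cong (λ x → indicator (P? x)) (triplesFirst-≥ k b j (3 * b + 0) (λ lt → <-irrefl (+-identityʳ _) lt)))))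

triple-straddles : ∀ i t x y → 3 * i ≤ x → x < 3 * t → 3 * t ≤ y → y < 3 * i + 3 → ⊥
triple-straddles i t x y 3i≤x x<3t 3t≤y y<3i+3 = <⇒≱ i<t t≤i
  where
  i<t : i < t
  i<t = *-cancelˡ-< 3 i t (≤-<-trans 3i≤x x<3t)
  t≤i : t ≤ i
  t≤i = ≤-pred (*-cancelˡ-< 3 t (suc i) (≤-<-trans 3t≤y (subst (y <_) (trans (+-comm (3 * i) 3) (sym (*-suc 3 i))) y<3i+3)))

-- The end of part j in the triple region is the multiple of 3 given by 3 ((j + 1) b).
triple-in-earlier-part : ∀ b i j o j' o' → o < 3 * b → j < j' →
  3 * i ≤ j * (3 * b) + o → j' * (3 * b) + o' < 3 * i + 3 → ⊥
triple-in-earlier-part b i j o j' o' o<3b j<j' l u = triple-straddles i (suc j * b) _ _ l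
  (subst (j * (3 * b) + o <_) (partEnd j b) (+-monoʳ-< (j * (3 * b)) o<3b))
  (≤-trans (≤-reflexive (sym (partEnd j b))) (≤-trans (≤-reflexive (+-comm (j * (3 * b)) (3 * b)))
     (≤-trans (*-monoˡ-≤ (3 * b) j<j') (m≤m+n _ o'))))
  u
  where
  partEnd : ∀ j b → j * (3 * b) + 3 * b ≡ 3 * (suc j * b)
  partEnd = solve-∀

sameTriple⇒samePart : ∀ b i j o j' o' → o < 3 * b → o' < 3 * b →
  3 * i ≤ j * (3 * b) + o → j * (3 * b) + o < 3 * i + 3 →
  3 * i ≤ j' * (3 * b) + o' → j' * (3 * b) + o' < 3 * i + 3 → j ≡ j'
sameTriple⇒samePart b i j o j' o' o<3b o'<3b l₁ u₁ l₂ u₂ with <-cmp j j'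
... | tri≈ _ j≡j' _ = j≡j'
... | tri< j<j' _ _ = ⊥-elim (triple-in-earlier-part b i j o j' o' o<3b j<j' l₁ u₂)
... | tri> _ _ j>j' = ⊥-elim (triple-in-earlier-part b i j' o' j o o'<3b j>j' l₂ u₁)

-- When the a ≤ kb classes of size 3 come first, each one is a triple of the triple region.
first-blocks-are-triples : ∀ k b m a i j o → a ≤ k * b → i < a →
  chunkIndex (balanced m 2 a) (triplesFirst k b j o) ≡ i →
  o < 3 * b × 3 * i ≤ j * (3 * b) + o × j * (3 * b) + o < 3 * i + 3
first-blocks-are-triples k b m a i j o a≤kb i<a idx≡i with o <? 3 * b
... | yes o<3b = o<3b , chunkIndex-replicate a 3 (replicate (m ∸ a) 2) (j * (3 * b) + o) i idx≡i i<a
... | no _     = ⊥-elim (<⇒≱ (proj₂ (chunkIndex-replicate a 3 (replicate (m ∸ a) 2) (k * (3 * b) + j) i idx≡i i<a)) (begin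
  3 * i + 3             ≡⟨ trans (+-comm (3 * i) 3) (sym (*-suc 3 i)) ⟩
  3 * suc i             ≤⟨ *-monoʳ-≤ 3 i<a ⟩
  3 * a                 ≤⟨ *-monoʳ-≤ 3 a≤kb ⟩
  3 * (k * b)           ≡⟨ lemma k b ⟩
  k * (3 * b)           ≤⟨ m≤m+n _ j ⟩
  k * (3 * b) + j       ∎))
  where
  open ≤-Reasoning
  lemma : ∀ k b → 3 * (k * b) ≡ k * (3 * b)
  lemma = solve-∀

-- With fewer than 3q vertices every class has size ≤ 3, and at most kb classes have size 3.
few-triples-colorable : ∀ k b q' → k * (3 * b + 1) < 3 * suc q' → k * (3 * b + 1) ≤ 2 * suc q' + k * b →
                        EqTreeColorable (K k (3 * b + 1)) (suc q') 1
few-triples-colorable k b q' N<3q N≤2q+kb =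
  ChunkColoring.colorable k n q' zs (triplesFirst k b) (triplesFirst-enumerates k b)
    length≡ sum≡ equitable forest
  where
  n = 3 * b + 1
  N = k * n
  s = N / suc q'
  a = N % suc q'
  zs = balanced (suc q') s a
  a<q : a < suc q'
  a<q = m%n<n N (suc q')
  N≡ : N ≡ s * suc q' + a
  N≡ = m≡[m/n]*n+m%n N q'
  s≤2 : s ≤ 2
  s≤2 = ≤-pred (m<n*o⇒m/o<n N<3q)
  length≡ : length zs ≡ suc q'
  length≡ = length-balanced (suc q') s a (<⇒≤ a<q)
  sum≡ : sum zs ≡ N
  sum≡ = trans (sum-balanced (suc q') s a (<⇒≤ a<q)) (trans (cong (_+ a) (*-comm (suc q') s)) (sym N≡))
  equitable : ∀ i → i < suc q' → nth zs i ≡ ⌊ N / suc q' ⌋ ⊎ nth zs i ≡ ⌈ N / suc q' ⌉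
  equitable i i<q with nth-balanced (suc q') s a i i<q
  ... | inj₂ e           = inj₁ e
  ... | inj₁ (i<a , e) = inj₂ (trans e (sym (⌈/⌉≡1+quotient q' N≡ (≤-trans (s≤s z≤n) i<a) a<q)))
  forest : ∀ i → i < suc q' → nth zs i ≤ 2 ⊎
    (∀ j o j' o' → j < k → o < n → j' < k → o' < n →
       chunkIndex zs (triplesFirst k b j o) ≡ i → chunkIndex zs (triplesFirst k b j' o') ≡ i → j ≡ j')
  forest i i<q with nth zs i ≤? 2
  ... | yes small = inj₁ small
  ... | no large with nth-balanced (suc q') s a i i<q
  ...   | inj₂ e           = ⊥-elim (large (subst (_≤ 2) (sym e) s≤2))
  ...   | inj₁ (i<a , e) = inj₂ λ j o j' o' _ _ _ _ idx≡i idx'≡i →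
    let (o<3b , l₁ , u₁)   = triple j o idx≡i
        (o'<3b , l₂ , u₂) = triple j' o' idx'≡i
    in sameTriple⇒samePart b i j o j' o' o<3b o'<3b l₁ u₁ l₂ u₂
    where
    s≡2 : s ≡ 2
    s≡2 = ≤-antisym s≤2 (≤-pred (subst (2 <_) e (≰⇒> large)))
    a≤kb : a ≤ k * b
    a≤kb = +-cancelˡ-≤ (2 * suc q') a (k * b) (subst (_≤ 2 * suc q' + k * b) (trans N≡ (cong (λ t → t * suc q' + a) s≡2)) N≤2q+kb)
    triple : ∀ j o → chunkIndex zs (triplesFirst k b j o) ≡ i →
             o < 3 * b × 3 * i ≤ j * (3 * b) + o × j * (3 * b) + o < 3 * i + 3
    triple j o idx≡i = first-blocks-are-triples k b (suc q') a i j o a≤kb i<a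
                         (subst (λ t → chunkIndex (balanced (suc q') t a) (triplesFirst k b j o) ≡ i) s≡2 idx≡i)

-- Part j is cut into m j classes of sizes s and s + 1, where s = ⌊2n/q⌋.
two-parts-colorable : ∀ n q' (m : Fin 2 → ℕ) → m zero + m (suc zero) ≡ suc q' → (∀ j → Fits n (m j) (2 * n / suc q')) →
                      EqTreeColorable (K 2 n) (suc q') 1
two-parts-colorable n q' m m₀+m₁≡q fits =
  ChunkColoring.colorable 2 n q' (block zero ++ block (suc zero)) (rowMajor n) (rowMajor-enumerates 2 n)
    length≡ sum≡ equitable (λ i _ → inj₂ samePart)
  where
  s = 2 * n / suc q'
  extra : Fin 2 → ℕ
  extra j = n ∸ m j * s
  extra≤m : ∀ j → extra j ≤ m j
  extra≤m j = ≤-trans (∸-monoˡ-≤ (m j * s) (proj₂ (fits j))) (≤-reflexive (m+n∸m≡n (m j * s) (m j)))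
  block : Fin 2 → List ℕ
  block j = balanced (m j) s (extra j)
  sum-block : ∀ j → sum (block j) ≡ n
  sum-block j = trans (sum-balanced (m j) s (extra j) (extra≤m j)) (m+[n∸m]≡n (proj₁ (fits j)))
  length-block : ∀ j → length (block j) ≡ m j
  length-block j = length-balanced (m j) s (extra j) (extra≤m j)
  length≡ : length (block zero ++ block (suc zero)) ≡ suc q'
  length≡ = trans (length-++ (block zero)) (trans (cong₂ _+_ (length-block zero) (length-block (suc zero))) m₀+m₁≡q)
  sum≡ : sum (block zero ++ block (suc zero)) ≡ 2 * n
  sum≡ = trans (sum-++ (block zero) _) (trans (cong₂ _+_ (sum-block zero) (sum-block (suc zero))) (cong (n +_) (sym (+-identityʳ n))))
  extras = extra zero + extra (suc zero)
  2n≡ : 2 * n ≡ s * suc q' + extras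
  2n≡ = begin
    2 * n                                                 ≡⟨ cong (n +_) (+-identityʳ n) ⟩
    n + n                                                 ≡⟨ cong₂ _+_ (m+[n∸m]≡n (proj₁ (fits zero))) (m+[n∸m]≡n (proj₁ (fits (suc zero)))) ⟨
    m zero * s + extra zero + (m (suc zero) * s + extra (suc zero)) ≡⟨ lemma (m zero) (m (suc zero)) s (extra zero) (extra (suc zero)) ⟩
    (m zero + m (suc zero)) * s + extras                  ≡⟨ cong (λ t → t * s + extras) m₀+m₁≡q ⟩
    suc q' * s + extras                                   ≡⟨ cong (_+ extras) (*-comm (suc q') s) ⟩
    s * suc q' + extras                                   ∎
    where
    open ≡-Reasoning
    lemma : ∀ m₀ m₁ s a₀ a₁ → m₀ * s + a₀ + (m₁ * s + a₁) ≡ (m₀ + m₁) * s + (a₀ + a₁)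
    lemma = solve-∀
  extras<q : extras < suc q'
  extras<q = subst (_< suc q') (+-cancelˡ-≡ (s * suc q') _ _ (trans (sym (m≡[m/n]*n+m%n (2 * n) q')) 2n≡))
                   (m%n<n (2 * n) (suc q'))
  Equitable : ℕ → Set
  Equitable z = z ≡ ⌊ 2 * n / suc q' ⌋ ⊎ z ≡ ⌈ 2 * n / suc q' ⌉
  equitable-block : ∀ j i → i < length (block j) → Equitable (nth (block j) i)
  equitable-block j i i<l with nth-balanced (m j) s (extra j) i (subst (i <_) (length-block j) i<l)
  ... | inj₂ e           = inj₁ e
  ... | inj₁ (i<a , e) = inj₂ (trans e (sym (⌈/⌉≡1+quotient q' 2n≡ (≤-trans (s≤s z≤n) (≤-trans i<a (extra≤extras j))) extras<q)))
    where
    extra≤extras : ∀ j → extra j ≤ extras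
    extra≤extras zero       = m≤m+n _ _
    extra≤extras (suc zero) = m≤n+m _ _
  equitable : ∀ i → i < suc q' → Equitable (nth (block zero ++ block (suc zero)) i)
  equitable i i<q = nth-++-∀ Equitable (block zero) (block (suc zero)) (equitable-block zero) (equitable-block (suc zero))
                      i (subst (i <_) (sym length≡) i<q)
  index = λ j o → chunkIndex (block zero ++ block (suc zero)) (rowMajor n j o)
  inPart₀ : ∀ o → o < n → index 0 o < m zero
  inPart₀ o o<n = subst (index 0 o <_) (length-block zero)
                    (chunkIndex-++-< (block zero) _ o (subst (o <_) (sym (sum-block zero)) o<n))
  inPart₁ : ∀ o → m zero ≤ index 1 o
  inPart₁ o = subst₂ _≤_ (length-block zero) (cong (λ x → chunkIndex (block zero ++ block (suc zero)) (x + o))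
                (trans (sum-block zero) (sym (+-identityʳ n)))) (chunkIndex-++-≥ (block zero) _ o)
  samePart : ∀ {i} j o j' o' → j < 2 → o < n → j' < 2 → o' < n → index j o ≡ i → index j' o' ≡ i → j ≡ j'
  samePart 0 o 0 o' _ _   _ _    _ _  = refl
  samePart 1 o 1 o' _ _   _ _    _ _  = refl
  samePart 0 o 1 o' _ o<n _ _    e e' = ⊥-elim (<⇒≱ (inPart₀ o o<n) (subst (m zero ≤_) (trans e' (sym e)) (inPart₁ o')))
  samePart 1 o 0 o' _ _   _ o'<n e e' = ⊥-elim (<⇒≱ (inPart₀ o' o'<n) (subst (m zero ≤_) (trans e (sym e')) (inPart₁ o)))
  samePart (suc (suc _)) _ _ _ (s≤s (s≤s ())) _ _ _ _ _
  samePart 0 _ (suc (suc _)) _ _ _ (s≤s (s≤s ())) _ _ _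
  samePart 1 _ (suc (suc _)) _ _ _ (s≤s (s≤s ())) _ _ _

module _ (G : Graph) where
  open Graph G using (N)

  maxDeg≤ : ∀ {q r c} → EqTreeColoring G q r c → ∀ v → classDeg G c v ≤ r
  maxDeg≤ {c = c} col v = proj₂ (proj₂ (col (c v))) v refl

  classSize-bounds : ∀ {q' r c} → EqTreeColoring G (suc q') r c →
                     ∀ i → N / suc q' ≤ classSize G c i × classSize G c i ≤ suc (N / suc q')
  classSize-bounds {q'} col i with proj₁ (col i)
  ... | inj₁ e = ≤-reflexive (sym e) , ≤-trans (≤-reflexive e) (n≤1+n _)
  ... | inj₂ e = ≤-trans (⌊/⌋≤⌈/⌉ N q') (≤-reflexive (sym e)) , ≤-trans (≤-reflexive e) (⌈/⌉≤1+⌊/⌋ N q')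

  isStrongEqVA : ∀ r {m} q → m ≡ suc q → 1 ≤ q → GoodFrom G r m → ¬ EqTreeColorable G q r → IsStrongEqVA G r m
  isStrongEqVA r {m} q m≡1+q 1≤q good ¬col = good , minimal
    where
    minimal : ∀ p → GoodFrom G r p → m ≤ p
    minimal p good-p with m ≤? p
    ... | yes m≤p = m≤p
    ... | no m≰p = ⊥-elim (¬col (good-p q (≤-pred (subst (p <_) m≡1+q (≰⇒> m≰p))) 1≤q))

k≤2⌈k/2⌉≤1+k : ∀ k → k ≤ ⌈ k /2⌉ + ⌈ k /2⌉ × ⌈ k /2⌉ + ⌈ k /2⌉ ≤ suc k
k≤2⌈k/2⌉≤1+k zero          = z≤n , z≤n
k≤2⌈k/2⌉≤1+k (suc zero)    = s≤s z≤n , s≤s (s≤s z≤n)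
k≤2⌈k/2⌉≤1+k (suc (suc k)) with k≤2⌈k/2⌉≤1+k k
... | lower , upper = subst (suc (suc k) ≤_) (twoMore ⌈ k /2⌉) (s≤s (s≤s lower)) ,
                      subst (_≤ suc (suc (suc k))) (twoMore ⌈ k /2⌉) (s≤s (s≤s upper))
  where
  twoMore : ∀ h → suc (suc (h + h)) ≡ suc h + suc h
  twoMore h = cong suc (sym (+-suc h h))

[3b+1]-split : ∀ k b → k * (3 * b + 1) ≡ 3 * (k * b) + k
[3b+1]-split = solve-∀

K-colorable-from : ∀ k b q' → 1 ≤ k → k * b + ⌈ k /2⌉ ≤ suc q' → EqTreeColorable (K k (3 * b + 1)) (suc q') 1
K-colorable-from k b q' 1≤k m≤q = few-triples-colorable k b q' N<3q N≤2q+X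
  where
  X = k * b
  h = ⌈ k /2⌉
  N<3q : k * (3 * b + 1) < 3 * suc q'
  N<3q = begin-strict
    k * (3 * b + 1) ≡⟨ [3b+1]-split k b ⟩
    3 * X + k       ≤⟨ +-monoʳ-≤ (3 * X) (proj₁ (k≤2⌈k/2⌉≤1+k k)) ⟩
    3 * X + (h + h) <⟨ +-monoʳ-< (3 * X) (m<m+n (h + h) (⌈n/2⌉-mono 1≤k)) ⟩
    3 * X + (h + h + h) ≡⟨ lemma X h ⟩
    3 * (X + h)     ≤⟨ *-monoʳ-≤ 3 m≤q ⟩
    3 * suc q'      ∎
    where
    open ≤-Reasoning
    lemma : ∀ X h → 3 * X + (h + h + h) ≡ 3 * (X + h)
    lemma = solve-∀
  N≤2q+X : k * (3 * b + 1) ≤ 2 * suc q' + X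
  N≤2q+X = begin
    k * (3 * b + 1) ≡⟨ [3b+1]-split k b ⟩
    3 * X + k       ≤⟨ +-monoʳ-≤ (3 * X) (proj₁ (k≤2⌈k/2⌉≤1+k k)) ⟩
    3 * X + (h + h) ≡⟨ lemma X h ⟩
    2 * (X + h) + X ≤⟨ +-monoˡ-≤ X (*-monoʳ-≤ 2 m≤q) ⟩
    2 * suc q' + X  ∎
    where
    open ≤-Reasoning
    lemma : ∀ X h → 3 * X + (h + h) ≡ 2 * (X + h) + X
    lemma = solve-∀

module _ (k n q' : ℕ) {c : Fin (k * n) → Fin (suc q')} (col : EqTreeColoring (K k n) (suc q') 1 c) where

  largeClasses≡q : 3 * suc q' ≤ k * n → largeClasses k n c (maxDeg≤ (K k n) col) ≡ suc q'
  largeClasses≡q 3q≤N = trans (sum-cong-≗ {suc q'} large) (trans (∑-const (suc q') 1) (*-identityʳ (suc q')))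
    where
    large : ∀ i → indicator (3 ≤? classSize (K k n) c i) ≡ 1
    large i with 3 ≤? classSize (K k n) c i
    ... | yes _    = refl
    ... | no small = ⊥-elim (small (≤-trans (m*n≤o⇒m≤o/n 3 (k * n) q' 3q≤N) (proj₁ (classSize-bounds (K k n) col i))))

  -- Below 3q vertices every class has at most 3 vertices.
  N≤2q+largeClasses : k * n < 3 * suc q' → k * n ≤ 2 * suc q' + largeClasses k n c (maxDeg≤ (K k n) col)
  N≤2q+largeClasses N<3q = begin
    k * n                                                   ≡⟨ ∑classSize≡ k n c ⟨
    ∑[ i < suc q' ] classSize (K k n) c i                   ≤⟨ ∑-mono-≤ (suc q') size≤ ⟩
    ∑[ i < suc q' ] (2 + indicator (3 ≤? classSize (K k n) c i))
      ≡⟨ ∑-distrib-+ {suc q'} (λ _ → 2) (λ i → indicator (3 ≤? classSize (K k n) c i)) ⟩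
    ∑[ i < suc q' ] 2 + largeClasses k n c (maxDeg≤ (K k n) col)
      ≡⟨ cong (_+ largeClasses k n c (maxDeg≤ (K k n) col)) (trans (∑-const (suc q') 2) (*-comm (suc q') 2)) ⟩
    2 * suc q' + largeClasses k n c (maxDeg≤ (K k n) col)  ∎
    where
    open ≤-Reasoning
    size≤ : ∀ i → classSize (K k n) c i ≤ 2 + indicator (3 ≤? classSize (K k n) c i)
    size≤ i with 3 ≤? classSize (K k n) c i
    ... | no small = ≤-trans (≤-pred (≰⇒> small)) (≤-reflexive (sym (+-identityʳ 2)))
    ... | yes _    = ≤-trans (proj₂ (classSize-bounds (K k n) col i)) (s≤s (≤-pred (m<n*o⇒m/o<n N<3q)))

-- q = kb + ⌈k/2⌉ − 1 colours leave room for neither at most kb classes of size ≥ 3 (if 3q ≤ N)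
-- nor N ≤ 2q + kb (if N < 3q).
K-not-colorable-below : ∀ k b q' → 3 ≤ k → suc (suc q') ≡ k * b + ⌈ k /2⌉ →
                        ¬ EqTreeColorable (K k (3 * b + 1)) (suc q') 1
K-not-colorable-below k b q' 3≤k 2+q'≡X+h (c , col) = byCases (3 * suc q' ≤? N)
  where
  n = 3 * b + 1
  N = k * n
  X = k * b
  h = ⌈ k /2⌉
  large≤X : largeClasses k n c (maxDeg≤ (K k n) col) ≤ X
  large≤X = largeClasses≤ k n c (maxDeg≤ (K k n) col) b (≤-trans (n≤1+n _) (≤-reflexive (lemma b)))
    where
    lemma : ∀ b → suc (suc (3 * b + 1)) ≡ 3 * suc b
    lemma = solve-∀
  X<q : X < suc q'
  X<q = s≤s (+-cancelʳ-≤ 2 X q' (≤-trans (+-monoʳ-≤ X (⌈n/2⌉-mono 3≤k))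
                                         (≤-reflexive (trans (sym 2+q'≡X+h) (+-comm 2 q')))))
  2q+X<N : 2 * suc q' + X < N
  2q+X<N = ≤-pred (begin
    suc (suc (2 * suc q' + X)) ≡⟨ lemma q' X ⟩
    2 * suc (suc q') + X       ≡⟨ cong (λ t → 2 * t + X) 2+q'≡X+h ⟩
    2 * (X + h) + X            ≡⟨ lemma′ X h ⟩
    3 * X + (h + h)            ≤⟨ +-monoʳ-≤ (3 * X) (proj₂ (k≤2⌈k/2⌉≤1+k k)) ⟩
    3 * X + suc k              ≡⟨ +-suc (3 * X) k ⟩
    suc (3 * X + k)            ≡⟨ cong suc ([3b+1]-split k b) ⟨
    suc N                      ∎)
    where
    open ≤-Reasoning
    lemma : ∀ q' X → suc (suc (2 * suc q' + X)) ≡ 2 * suc (suc q') + X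
    lemma = solve-∀
    lemma′ : ∀ X h → 2 * (X + h) + X ≡ 3 * X + (h + h)
    lemma′ = solve-∀
  byCases : Dec (3 * suc q' ≤ N) → ⊥
  byCases (yes 3q≤N) = <⇒≱ (≤-<-trans large≤X X<q) (≤-reflexive (sym (largeClasses≡q k n q' col 3q≤N)))
  byCases (no 3q≰N)  = <⇒≱ 2q+X<N (≤-trans (N≤2q+largeClasses k n q' col (≰⇒> 3q≰N)) (+-monoʳ-≤ (2 * suc q') large≤X))

K-va : ∀ k b → 3 ≤ k → IsStrongEqVA (K k (3 * b + 1)) 1 (k * b + ⌈ k /2⌉)
K-va k b 3≤k = isStrongEqVA (K k (3 * b + 1)) 1 (suc q') m≡ (s≤s z≤n) good (K-not-colorable-below k b q' 3≤k (sym m≡))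
  where
  h≥2 : 2 ≤ ⌈ k /2⌉
  h≥2 = ⌈n/2⌉-mono 3≤k
  q' = k * b + ⌈ k /2⌉ ∸ 2
  m≡ : k * b + ⌈ k /2⌉ ≡ suc (suc q')
  m≡ = trans (sym (m∸n+n≡m (≤-trans h≥2 (m≤n+m _ (k * b))))) (+-comm _ 2)
  good : GoodFrom (K k (3 * b + 1)) 1 (k * b + ⌈ k /2⌉)
  good zero    _   ()
  good (suc q) m≤q _ = K-colorable-from k b q (≤-trans (s≤s z≤n) 3≤k) m≤q

LeastNondivisorFrom : ℕ → ℕ → ℕ → Set
LeastNondivisorFrom m n d = m ≤ d × ¬ d ∣ n × (∀ d' → m ≤ d' → d' < d → d' ∣ n)

⌈/⌉*-bounds : ∀ n d'' → n ≤ ⌈ n / suc d'' ⌉ * suc d'' × ⌈ n / suc d'' ⌉ * suc d'' < n + suc d''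
⌈/⌉*-bounds n d'' =
  +-cancelʳ-≤ d'' n (e * suc d'') (subst (_≤ e * suc d'' + d'') (sym n+d''≡) (+-monoʳ-≤ (e * suc d'') (≤-pred (m%n<n (n + d'') (suc d''))))) ,
  ≤-<-trans (subst (e * suc d'' ≤_) (sym n+d''≡) (m≤m+n _ _)) (+-monoʳ-< n (n<1+n d''))
  where
  e = ⌈ n / suc d'' ⌉
  n+d''≡ : n + d'' ≡ e * suc d'' + (n + d'') % suc d''
  n+d''≡ = m≡[m/n]*n+m%n (n + d'') d''

3M+2≢3b+1 : ∀ M b → 3 * M + 2 ≢ 3 * b + 1
3M+2≢3b+1 M b 3M+2≡3b+1 = 2≢1 (begin
  2                 ≡⟨ [m+kn]%n≡m%n 2 M 3 ⟨
  (2 + M * 3) % 3   ≡⟨ cong (_% 3) (lemma M 2) ⟩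
  (3 * M + 2) % 3   ≡⟨ cong (_% 3) 3M+2≡3b+1 ⟩
  (3 * b + 1) % 3   ≡⟨ cong (_% 3) (lemma b 1) ⟨
  (1 + b * 3) % 3   ≡⟨ [m+kn]%n≡m%n 1 b 3 ⟩
  1                 ∎)
  where
  open ≡-Reasoning
  2≢1 : 2 ≢ 1
  2≢1 ()
  lemma : ∀ M r → r + M * 3 ≡ 3 * M + r
  lemma = solve-∀

even-halves-fit : ∀ n M s → s * (M + M) ≤ 2 * n → 2 * n < suc s * (M + M) → Fits n M s
even-halves-fit n M s lower upper =
  *-cancelˡ-≤ 2 (≤-trans (≤-reflexive (lemma M s)) lower) ,
  <⇒≤ (*-cancelˡ-< 2 n (M * s + M) (≤-trans upper (≤-reflexive (lemma′ M s))))
  where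
  lemma : ∀ M s → 2 * (M * s) ≡ s * (M + M)
  lemma = solve-∀
  lemma′ : ∀ M s → suc s * (M + M) ≡ 2 * (M * s + M)
  lemma′ = solve-∀

-- If n > M (s + 1), then D = s + 1 < d divides n with M < n / D, contradicting 2n < (2M + 1) D.
odd-halves-upper : ∀ n d M s → LeastNondivisorFrom 4 n d → 3 ≤ s → n ≤ M * d →
                   2 * n < suc s * suc (2 * M) → n ≤ M * s + M
odd-halves-upper n d M s (_ , _ , least) 3≤s n≤Md 2n<Dq with n ≤? M * s + M
... | yes fits = fits
... | no n≰ = ⊥-elim (<⇒≱ M<r r≤M)
  where
  D = suc s
  MD<n : M * D < n
  MD<n = subst (_< n) (sym (trans (*-suc M s) (+-comm M (M * s)))) (≰⇒> n≰)
  D<d : D < d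
  D<d = *-cancelˡ-< M D d (<-≤-trans MD<n n≤Md)
  D∣n = least D (s≤s 3≤s) D<d
  r = _∣_.quotient D∣n
  n≡rD : n ≡ r * D
  n≡rD = _∣_.equality D∣n
  M<r : M < r
  M<r = *-cancelʳ-< D M r (subst (M * D <_) n≡rD MD<n)
  r≤M : r ≤ M
  r≤M = *-cancelˡ-≤ 2 (≤-pred (*-cancelʳ-< D (2 * r) (suc (2 * M))
          (subst₂ _<_ (trans (cong (2 *_) n≡rD) (sym (*-assoc 2 r D))) (*-comm D (suc (2 * M))) 2n<Dq)))

-- If n < (M + 1) s, then either s = 3 and n = 3M + 2, or s < d divides n with n / s ≤ M < n / s.
odd-halves-lower : ∀ b d M s → LeastNondivisorFrom 4 (3 * b + 1) d → 3 ≤ s → 3 * b + 1 ≤ M * d →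
                   s * suc (2 * M) ≤ 2 * (3 * b + 1) → suc M * s ≤ 3 * b + 1
odd-halves-lower b d M s (_ , _ , least) 3≤s n≤Md sq≤2n with suc M * s ≤? 3 * b + 1
... | yes fits = fits
... | no n≱ = ⊥-elim (byCases (s ≟ 3))
  where
  n = 3 * b + 1
  n<[M+1]s : n < suc M * s
  n<[M+1]s = ≰⇒> n≱
  qs≤2n : 2 * (M * s) + s ≤ 2 * n
  qs≤2n = subst (_≤ 2 * n) (lemma M s) sq≤2n
    where
    lemma : ∀ M s → s * suc (2 * M) ≡ 2 * (M * s) + s
    lemma = solve-∀
  byCases : Dec (s ≡ 3) → ⊥
  byCases (yes refl) = 3M+2≢3b+1 M b (≤-antisym 3M+2≤n (≤-pred (subst (n <_) (lemma M) n<[M+1]s)))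
    where
    lemma : ∀ M → suc M * 3 ≡ suc (3 * M + 2)
    lemma = solve-∀
    lemma′ : ∀ M → 2 * (M * 3) + 3 ≡ suc (2 * (3 * M + 1))
    lemma′ = solve-∀
    3M+2≤n : 3 * M + 2 ≤ n
    3M+2≤n with 3 * M + 2 ≤? n
    ... | yes ok = ok
    ... | no n< = ⊥-elim (<⇒≱ (subst (_≤ 2 * n) (lemma′ M) qs≤2n) (*-monoʳ-≤ 2 (≤-pred (subst (n <_) (+-suc (3 * M) 1) (≰⇒> n<)))))
  byCases (no s≢3) = <⇒≱ M<r r≤M
    where
    4≤s : 4 ≤ s
    4≤s = ≤∧≢⇒< 3≤s (λ e → s≢3 (sym e))
    s<d : s < d
    s<d with d ≤? s
    ... | no d≰s = ≰⇒> d≰s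
    ... | yes d≤s = ⊥-elim (<⇒≱ (m<m+n (2 * (M * s)) (≤-trans (s≤s z≤n) 4≤s))
                      (≤-trans qs≤2n (*-monoʳ-≤ 2 (≤-trans n≤Md (*-monoʳ-≤ M d≤s)))))
    s∣n = least s 4≤s s<d
    r = _∣_.quotient s∣n
    n≡rs : n ≡ r * s
    n≡rs = _∣_.equality s∣n
    r≤M : r ≤ M
    r≤M = ≤-pred (*-cancelʳ-< s r (suc M) (subst (_< suc M * s) n≡rs n<[M+1]s))
    M<r : M < r
    M<r = *-cancelˡ-< 2 M r (*-cancelʳ-≤ (suc (2 * M)) (2 * r) s ⦃ >-nonZero (≤-trans (s≤s z≤n) 4≤s) ⦄
            (subst₂ _≤_ (*-comm s (suc (2 * M))) (trans (cong (2 *_) n≡rs) (sym (*-assoc 2 r s))) sq≤2n))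

⌈n/2⌉≡⌊n/2⌋⊎1+⌊n/2⌋ : ∀ q → ⌈ q /2⌉ ≡ ⌊ q /2⌋ ⊎ ⌈ q /2⌉ ≡ suc ⌊ q /2⌋
⌈n/2⌉≡⌊n/2⌋⊎1+⌊n/2⌋ zero          = inj₁ refl
⌈n/2⌉≡⌊n/2⌋⊎1+⌊n/2⌋ (suc zero)    = inj₂ refl
⌈n/2⌉≡⌊n/2⌋⊎1+⌊n/2⌋ (suc (suc q)) with ⌈n/2⌉≡⌊n/2⌋⊎1+⌊n/2⌋ q
... | inj₁ e = inj₁ (cong suc e)
... | inj₂ e = inj₂ (cong suc e)

-- For odd q the minimality of d decides the rounding.
halves-fit : ∀ b d'' → LeastNondivisorFrom 4 (3 * b + 1) (suc d'') → ∀ q' → 2 * ⌈ 3 * b + 1 / suc d'' ⌉ ≤ suc q' →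
             3 * suc q' ≤ 2 * (3 * b + 1) →
             Fits (3 * b + 1) ⌊ suc q' /2⌋ (2 * (3 * b + 1) / suc q') × Fits (3 * b + 1) ⌈ suc q' /2⌉ (2 * (3 * b + 1) / suc q')
halves-fit b d'' least q' 2e≤q 3q≤2n with ⌈n/2⌉≡⌊n/2⌋⊎1+⌊n/2⌋ (suc q')
... | inj₁ even = fitsM , subst (λ t → Fits n t s) (sym even) fitsM
  where
  n = 3 * b + 1
  q = suc q'
  s = 2 * n / q
  M = ⌊ q /2⌋
  q≡ : q ≡ M + M
  q≡ = trans (sym (⌊n/2⌋+⌈n/2⌉≡n q)) (cong (M +_) even)
  fitsM : Fits n M s
  fitsM = even-halves-fit n M s (subst (λ t → s * t ≤ 2 * n) q≡ (m/n*n≤m (2 * n) q))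
                                (subst (λ t → 2 * n < suc s * t) q≡ (m<[1+m/n]*n (2 * n) q'))
... | inj₂ odd = (≤-trans (*-monoˡ-≤ s (n≤1+n M)) lower , upper) ,
                 subst (λ t → Fits n t s) (sym odd) (lower , ≤-trans upper (+-mono-≤ (*-monoˡ-≤ s (n≤1+n M)) (n≤1+n M)))
  where
  n = 3 * b + 1
  q = suc q'
  d = suc d''
  s = 2 * n / q
  M = ⌊ q /2⌋
  e = ⌈ n / d ⌉
  q≡ : q ≡ suc (2 * M)
  q≡ = trans (sym (⌊n/2⌋+⌈n/2⌉≡n q)) (trans (cong (M +_) odd) (trans (+-suc M M) (cong (λ t → suc (M + t)) (sym (+-identityʳ M)))))
  e≤M : e ≤ M
  e≤M with e ≤? M
  ... | yes e≤M = e≤M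
  ... | no e≰M = ⊥-elim (1+n≰n (≤-trans (≤-reflexive (lemma M))
                   (≤-trans (*-monoʳ-≤ 2 (≰⇒> e≰M)) (≤-trans 2e≤q (≤-reflexive q≡)))))
    where
    lemma : ∀ M → suc (suc (2 * M)) ≡ 2 * suc M
    lemma = solve-∀
  n≤Md : n ≤ M * d
  n≤Md = ≤-trans (proj₁ (⌈/⌉*-bounds n d'')) (*-monoˡ-≤ d e≤M)
  3≤s : 3 ≤ s
  3≤s = m*n≤o⇒m≤o/n 3 (2 * n) q' 3q≤2n
  upper : n ≤ M * s + M
  upper = odd-halves-upper n d M s least 3≤s n≤Md (subst (λ t → 2 * n < suc s * t) q≡ (m<[1+m/n]*n (2 * n) q'))
  lower : suc M * s ≤ n
  lower = odd-halves-lower b d M s least 3≤s n≤Md (subst (λ t → s * t ≤ 2 * n) q≡ (m/n*n≤m (2 * n) q))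

-- Below 3q vertices the triple layout works; otherwise each part takes half of the colours.
K₂-colorable-from : ∀ b d'' → LeastNondivisorFrom 4 (3 * b + 1) (suc d'') →
                    ∀ q' → 2 * ⌈ 3 * b + 1 / suc d'' ⌉ ≤ suc q' → EqTreeColorable (K 2 (3 * b + 1)) (suc q') 1
K₂-colorable-from b d'' least q' 2e≤q with 3 * suc q' ≤? 2 * (3 * b + 1)
... | no 3q≰2n = few-triples-colorable 2 b q' (≰⇒> 3q≰2n) (begin
  2 * (3 * b + 1)         ≡⟨ lemma b ⟩
  2 * (2 * b + 1) + 2 * b ≤⟨ +-monoˡ-≤ (2 * b) (*-monoʳ-≤ 2 (*-cancelˡ-≤ {2 * b + 1} {suc q'} 3 (≤-trans (≤-reflexive (lemma′ b)) (≰⇒> 3q≰2n)))) ⟩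
  2 * suc q' + 2 * b      ∎)
  where
  open ≤-Reasoning
  lemma : ∀ b → 2 * (3 * b + 1) ≡ 2 * (2 * b + 1) + 2 * b
  lemma = solve-∀
  lemma′ : ∀ b → 3 * (2 * b + 1) ≡ suc (2 * (3 * b + 1))
  lemma′ = solve-∀
... | yes 3q≤2n = two-parts-colorable (3 * b + 1) q' halves (⌊n/2⌋+⌈n/2⌉≡n (suc q')) fits
  where
  halves : Fin 2 → ℕ
  halves zero    = ⌊ suc q' /2⌋
  halves (suc _) = ⌈ suc q' /2⌉
  fits : ∀ j → Fits (3 * b + 1) (halves j) (2 * (3 * b + 1) / suc q')
  fits zero    = proj₁ (halves-fit b d'' least q' 2e≤q 3q≤2n)
  fits (suc _) = proj₂ (halves-fit b d'' least q' 2e≤q 3q≤2n)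

-- Parts holding x ≥ e and y < e classes give s e ≤ n ≤ (s + 1)(e − 1), i.e. d ≤ s and then n = e d.
unequal-parts-impossible : ∀ n d e' s x y → ¬ d ∣ n → n ≤ suc e' * d → e' * d < n →
                           suc e' ≤ x → y ≤ e' → s * x ≤ n → n ≤ suc s * y → ⊥
unequal-parts-impossible n d e' s x y d∤n n≤ed e'd<n e≤x y≤e' sx≤n n≤[s+1]y with suc s ≤? d
... | yes s<d = <⇒≱ e'd<n (≤-trans n≤[s+1]y (≤-trans (*-monoˡ-≤ y s<d) (≤-trans (*-monoʳ-≤ d y≤e') (≤-reflexive (*-comm d e')))))
... | no s≮d = d∤n (divides (suc e') (≤-antisym n≤ed (≤-trans (*-monoʳ-≤ (suc e') (≤-pred (≰⇒> s≮d)))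
                     (≤-trans (*-monoˡ-≤ s e≤x) (≤-trans (≤-reflexive (*-comm x s)) sx≤n)))))

odd-sum-split : ∀ x y e' → x + y ≡ suc (e' + e') → (suc e' ≤ x × y ≤ e') ⊎ (suc e' ≤ y × x ≤ e')
odd-sum-split x y e' x+y≡ with suc e' ≤? x | suc e' ≤? y
... | yes e≤x | _ = inj₁ (e≤x , +-cancelˡ-≤ (suc e') y e' (≤-trans (+-monoˡ-≤ y e≤x) (≤-reflexive x+y≡)))
... | no e≰x | yes e≤y = inj₂ (e≤y , ≤-pred (≰⇒> e≰x))
... | no e≰x | no e≰y = ⊥-elim (<⇒≱ (s≤s (+-mono-≤ (≤-pred (≰⇒> e≰x)) (≤-pred (≰⇒> e≰y)))) (≤-reflexive (sym x+y≡)))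

3[2e'+1]≤2[3b+1] : ∀ b e' → 1 ≤ b → 4 * e' ≤ 3 * b → 3 * suc (e' + e') ≤ 2 * (3 * b + 1)
3[2e'+1]≤2[3b+1] b zero    1≤b _ = ≤-trans (s≤s (s≤s (s≤s z≤n))) (*-monoʳ-≤ 2 (+-monoˡ-≤ 1 (*-monoʳ-≤ 3 1≤b)))
3[2e'+1]≤2[3b+1] b (suc f) _ 4e'≤3b = begin
  3 * suc (suc f + suc f)           ≤⟨ m≤m+n _ (2 * f + 1) ⟩
  3 * suc (suc f + suc f) + (2 * f + 1) ≡⟨ lemma f ⟩
  2 * (4 * suc f) + 2               ≤⟨ +-monoˡ-≤ 2 (*-monoʳ-≤ 2 4e'≤3b) ⟩
  2 * (3 * b) + 2                   ≡⟨ lemma′ b ⟩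
  2 * (3 * b + 1)                   ∎
  where
  open ≤-Reasoning
  lemma : ∀ f → 3 * suc (suc f + suc f) + (2 * f + 1) ≡ 2 * (4 * suc f) + 2
  lemma = solve-∀
  lemma′ : ∀ b → 2 * (3 * b) + 2 ≡ 2 * (3 * b + 1)
  lemma′ = solve-∀

-- With 2e − 1 colours all classes have ≥ 3 vertices, so each lies in one part; one part then
-- holds ≥ e classes and the other < e.
K₂-not-colorable-below : ∀ b d'' → 1 ≤ b → LeastNondivisorFrom 4 (3 * b + 1) (suc d'') →
                         ∀ e' → ⌈ 3 * b + 1 / suc d'' ⌉ ≡ suc e' → ¬ EqTreeColorable (K 2 (3 * b + 1)) (suc (e' + e')) 1
K₂-not-colorable-below b d'' 1≤b (4≤d , d∤n , _) e' e≡ (c , col) =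
  unequal (odd-sum-split (parts zero) (parts (suc zero)) e' (trans (cong (parts zero +_) (sym (+-identityʳ _)))
                                                                  (∑classesIn≡q 2 n c deg≤1 allLarge)))
  where
  n = 3 * b + 1
  d = suc d''
  q' = e' + e'
  s = 2 * n / suc q'
  n≤ed : n ≤ suc e' * d
  n≤ed = subst (λ t → n ≤ t * d) e≡ (proj₁ (⌈/⌉*-bounds n d''))
  e'd<n : e' * d < n
  e'd<n = +-cancelˡ-< d (e' * d) n (subst (d + e' * d <_) (+-comm n d) (subst (λ t → t * d < n + d) e≡ (proj₂ (⌈/⌉*-bounds n d''))))
  3q≤2n : 3 * suc q' ≤ 2 * n
  3q≤2n = 3[2e'+1]≤2[3b+1] b e' 1≤b (≤-pred (≤-trans (s≤s (≤-trans (*-monoˡ-≤ e' 4≤d) (≤-reflexive (*-comm d e'))))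
                                                (≤-trans e'd<n (≤-reflexive (+-comm (3 * b) 1)))))
  deg≤1 = maxDeg≤ (K 2 n) col
  sizes = classSize-bounds (K 2 n) col
  allLarge : ∀ i → 3 ≤ classSize (K 2 n) c i
  allLarge i = ≤-trans (m*n≤o⇒m≤o/n 3 (2 * n) q' 3q≤2n) (proj₁ (sizes i))
  parts = classesIn 2 n c deg≤1 allLarge
  bounds = classesIn-bounds 2 n c deg≤1 allLarge s sizes
  impossible : ∀ j j' → suc e' ≤ parts j → parts j' ≤ e' → ⊥
  impossible j j' e≤x y≤e' =
    unequal-parts-impossible n d e' s (parts j) (parts j') d∤n n≤ed e'd<n e≤x y≤e' (proj₁ (bounds j)) (proj₂ (bounds j'))
  unequal : (suc e' ≤ parts zero × parts (suc zero) ≤ e') ⊎ (suc e' ≤ parts (suc zero) × parts zero ≤ e') → ⊥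
  unequal (inj₁ (e≤x , y≤e')) = impossible zero (suc zero) e≤x y≤e'
  unequal (inj₂ (e≤y , x≤e')) = impossible (suc zero) zero e≤y x≤e'

K₂-va : ∀ b d → 1 ≤ b → LeastNondivisorFrom 4 (3 * b + 1) d → IsStrongEqVA (K 2 (3 * b + 1)) 1 (2 * ⌈ 3 * b + 1 / d ⌉)
K₂-va b zero          _   (() , _)
K₂-va b d@(suc d'') 1≤b least with ⌈ 3 * b + 1 / d ⌉ in e≡
... | zero   = ⊥-elim (<⇒≱ (s≤s z≤n) (≤-trans (m≤n+m 1 (3 * b)) (subst (λ t → 3 * b + 1 ≤ t * d) e≡ (proj₁ (⌈/⌉*-bounds (3 * b + 1) d'')))))
... | suc e' = isStrongEqVA (K 2 (3 * b + 1)) 1 (suc (e' + e')) (lemma e') (s≤s z≤n)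
                 good (K₂-not-colorable-below b d'' 1≤b least e' e≡)
  where
  good : GoodFrom (K 2 (3 * b + 1)) 1 (2 * suc e')
  good zero     _   ()
  good (suc q') m≤q _ = K₂-colorable-from b d'' least q' (subst (λ t → 2 * t ≤ suc q') (sym e≡) m≤q)
  lemma : ∀ e' → 2 * suc e' ≡ suc (suc (e' + e'))
  lemma = solve-∀

least-nondivisor-from : ∀ m n → 0 < n → Σ ℕ (LeastNondivisorFrom m n)
least-nondivisor-from m n 0<n = search (suc n) m ≤-refl (λ d' m≤d' d'<m → ⊥-elim (<⇒≱ d'<m m≤d')) (m≤n+m (suc n) m)
  where
  -- A divisor of n is at most n, so the fuel bounds the number of candidates left.
  search : ∀ fuel d → m ≤ d → (∀ d' → m ≤ d' → d' < d → d' ∣ n) → n < d + fuel → Σ ℕ (LeastNondivisorFrom m n)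
  search fuel d m≤d below n<d+fuel with d ∣? n
  ... | no d∤n = d , m≤d , d∤n , below
  ... | yes d∣n with fuel
  ...   | zero   = ⊥-elim (<⇒≱ (subst (n <_) (+-identityʳ d) n<d+fuel) (∣⇒≤ ⦃ >-nonZero 0<n ⦄ d∣n))
  ...   | suc f = search f (suc d) (m≤n⇒m≤1+n m≤d) below′ (subst (n <_) (+-suc d f) n<d+fuel)
    where
    below′ : ∀ d' → m ≤ d' → d' < suc d → d' ∣ n
    below′ d' m≤d' d'<1+d with d' <? d
    ... | yes d'<d = below d' m≤d' d'<d
    ... | no d'≮d = subst (_∣ n) (≤-antisym (≮⇒≥ d'≮d) (≤-pred d'<1+d)) d∣n

-- Condition (ii) can only hold at an entry not divisible by d.
divides-all⇒¬CondPD : ∀ ns d → (∀ i → d ∣ lookup ns i) → ¬ CondPD ns d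
divides-all⇒¬CondPD ns d d∣ (inj₁ (i , _ , _ , d∤nᵢ , _)) = d∤nᵢ (d∣ i)
divides-all⇒¬CondPD ns zero d∣ (inj₂ (i , () , _))
divides-all⇒¬CondPD ns (suc d') d∣ (inj₂ (i , _ , [d+1]⌊nᵢ/d⌋<nᵢ)) with d∣ i
... | divides t nᵢ≡td = <⇒≱ [d+1]⌊nᵢ/d⌋<nᵢ (begin
  lookup ns i                ≡⟨ nᵢ≡td ⟩
  t * suc d'                 ≡⟨ *-comm t (suc d') ⟩
  suc d' * t                 ≤⟨ *-monoˡ-≤ t (n≤1+n (suc d')) ⟩
  suc (suc d') * t           ≡⟨ cong (suc (suc d') *_) (trans (cong (_/ suc d') nᵢ≡td) (m*n/n≡m t (suc d'))) ⟨
  suc (suc d') * (lookup ns i / suc d') ∎)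
  where open ≤-Reasoning

⌈2[3b+1]/2b⌉≡4 : ∀ b → 1 ≤ b → ⌈ sum ((3 * b + 1) ∷ (3 * b + 1) ∷ []) / 2 * b ⌉ ≡ 4
⌈2[3b+1]/2b⌉≡4 (suc b') _ = ⌈/⌉-unique (b' + (suc b' + 0)) (≤-trans (m≤m+n _ 1) (≤-reflexive (lemma b')))
                                                          (≤-trans (m≤m+n _ (2 * b')) (≤-reflexive (lemma′ b')))
  where
  lemma : ∀ b' → suc (3 * suc (b' + (suc b' + 0))) + 1 ≡ (3 * suc b' + 1) + ((3 * suc b' + 1) + 0)
  lemma = solve-∀
  lemma′ : ∀ b' → (3 * suc b' + 1) + ((3 * suc b' + 1) + 0) + 2 * b' ≡ 4 * suc (b' + (suc b' + 0))
  lemma′ = solve-∀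

isPD-least-nondivisor : ∀ b d → 1 ≤ b → LeastNondivisorFrom 4 (3 * b + 1) d →
                        IsPD (2 * b) ((3 * b + 1) ∷ (3 * b + 1) ∷ []) d
isPD-least-nondivisor b d 1≤b (4≤d , d∤n , least) =
  subst (_≤ d) (sym (⌈2[3b+1]/2b⌉≡4 b 1≤b)) 4≤d ,
  inj₁ (zero , suc zero , (λ ()) , d∤n , d∤n) ,
  minimal
  where
  minimal : ∀ d' → ⌈ sum ((3 * b + 1) ∷ (3 * b + 1) ∷ []) / 2 * b ⌉ ≤ d' → CondPD ((3 * b + 1) ∷ (3 * b + 1) ∷ []) d' → d ≤ d'
  minimal d' ⌈⌉≤d' cond with d ≤? d'
  ... | yes d≤d' = d≤d'
  ... | no d≰d' = ⊥-elim (divides-all⇒¬CondPD _ d' (λ { zero → d'∣n ; (suc zero) → d'∣n }) cond)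
    where
    d'∣n = least d' (subst (_≤ d') (⌈2[3b+1]/2b⌉≡4 b 1≤b) ⌈⌉≤d') (≰⇒> d≰d')

-- K₂-va fits the second component because pFrom (n ∷ n ∷ []) d computes to 2 * ⌈ n / d ⌉.
lemma15 : (b : ℕ) → 1 ≤ b →
    (Σ ℕ (λ d → IsPD (2 * b) ((3 * b + 1) ∷ (3 * b + 1) ∷ []) d
       × IsStrongEqVA (K 2 (3 * b + 1)) 1 (pFrom ((3 * b + 1) ∷ (3 * b + 1) ∷ []) d)))
    × ((k : ℕ) → 3 ≤ k → IsStrongEqVA (K k (3 * b + 1)) 1 (k * b + ⌈ k /2⌉))
lemma15 b 1≤b = (d , isPD-least-nondivisor b d 1≤b least , K₂-va b d 1≤b least) , λ k 3≤k → K-va k b 3≤k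
  where
  nondivisor = least-nondivisor-from 4 (3 * b + 1) (m≤n+m 1 (3 * b))
  d = proj₁ nondivisor
  least = proj₂ nondivisor
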